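{- For every integer $k\geq 3$, every constant degree bound $d$, every constant treewidth bound $t$ and every constant $\varepsilon\in(0,1)$, $k$-partiteness is strongly testable within the class of $k$-uniform $n$-vertex hypergraphs of maximum degree at most $d$ whose Gaifman graph has treewidth at most $t$: there is an $\varepsilon$-tester for $k$-partiteness, for inputs promised to lie in this class, whose query complexity does not depend on $n$.
   Context: A hypergraph is $k$-uniform if every hyperedge has exactly $k$ vertices; it is $k$-partite if there is a map $V(H)\to\{1,\dots,k\}$ giving the $k$ vertices of every hyperedge $k$ distinct colors. The Gaifman (primal) graph of $H$ has vertex set $V(H)$, two vertices adjacent iff they lie in a common hyperedge; the treewidth of $H$ is that of its Gaifman graph. Bounded degree model: a hypergraph of maximum degree at most $d$ is accessed via queries to lists $A_1,\dots,A_n$ of length $d$, $A_i$ listing the hyperedges incident to $i$ padded with $\bot$. Distance between $H_1=([n],E_1)$, $H_2=([n],E_2)$ is $(|E_1\setminus E_2|+|E_2\setminus E_1|)/(dn)$; $H$ is $\varepsilon$-far from a property if its distance to every $k$-uniform $n$-vertex hypergraph with the property exceeds $\varepsilon$. An $\varepsilon$-tester accepts with probability $\ge 2/3$ inputs with the property and with probability $\le 1/3$ inputs $\varepsilon$-far from it. Strongly testable means such a tester exists with query complexity independent of $n$.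
   Formalization: The constant ε ranges only over the rational numbers in $(0,1)$. -}

module Defs where

open import Data.Nat using (ℕ; zero; suc; _+_; _*_; _≤_; _<_)
open import Data.Bool using (Bool; true; false; if_then_else_; _xor_)
open import Data.Fin using (Fin; toℕ)
open import Data.Fin.Subset using (Subset; _∈_; ∣_∣)
open import Data.Vec using (Vec; []; _∷_; lookup)
open import Data.Maybe using (Maybe; just; nothing)
open import Data.Product using (Σ; ∃; _×_; _,_)
open import Relation.Binary.PropositionalEquality using (_≡_; _≢_)
open import Relation.Nullary using (¬_)

-- A hypergraph on vertex set Fin n: its hyperedge set, given as the
-- (Boolean) indicator function on subsets of Fin n.
Hypergraph : ℕ → Set
Hypergraph n = Subset n → Bool

Uniform : ∀ {n} → ℕ → Hypergraph n → Set
Uniform k E = ∀ e → E e ≡ true → ∣ e ∣ ≡ k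

Partite : ∀ {n} → ℕ → Hypergraph n → Set
Partite {n} k E = Σ (Fin n → Fin k) λ c →
  ∀ e → E e ≡ true → ∀ u v → u ∈ e → v ∈ e → u ≢ v → c u ≢ c v

GaifmanAdj : ∀ {n} → Hypergraph n → Fin n → Fin n → Set
GaifmanAdj E u v = u ≢ v × ∃ λ e → E e ≡ true × u ∈ e × v ∈ e

-- Rooted trees on node set Fin (suc m): node 0 is the root and node
-- (suc j) has parent (par j), whose index is at most j.  Every finite
-- tree admits such a numbering.
record RootedTree (m : ℕ) : Set where
  field
    par     : Fin m → Fin (suc m)
    par-ord : ∀ j → toℕ (par j) ≤ toℕ j

open RootedTree public

TreeAdj : ∀ {m} → RootedTree m → Fin (suc m) → Fin (suc m) → Set
TreeAdj {m} T a b = (∃ λ j → a ≡ Fin.suc j × par T j ≡ b)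
                  ⊎' (∃ λ j → b ≡ Fin.suc j × par T j ≡ a)
  where
  open import Data.Sum using () renaming (_⊎_ to _⊎'_)

data ReachIn {m} (T : RootedTree m) (S : Fin (suc m) → Set)
     : Fin (suc m) → Fin (suc m) → Set where
  here : ∀ {a} → S a → ReachIn T S a a
  step : ∀ {a b c} → S a → TreeAdj T a b → ReachIn T S b c → ReachIn T S a c

record TreeDecomposition {n} (E : Hypergraph n) (t : ℕ) : Set where
  field
    m      : ℕ
    tree   : RootedTree m
    bag    : Fin (suc m) → Subset n
    width  : ∀ x → ∣ bag x ∣ ≤ suc t
    vcover : ∀ (v : Fin n) → ∃ λ x → v ∈ bag x
    ecover : ∀ u v → GaifmanAdj E u v → ∃ λ x → u ∈ bag x × v ∈ bag x
    connected : ∀ (v : Fin n) x y → v ∈ bag x → v ∈ bag y →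
                ReachIn tree (λ z → v ∈ bag z) x y

TreewidthAtMost : ∀ {n} → ℕ → Hypergraph n → Set
TreewidthAtMost t E = TreeDecomposition E t

-- Bounded-degree representation: lists A_1..A_n of length d, where A_i
-- lists the hyperedges containing i (each once), padded with ⊥ (nothing).
Oracle : ℕ → ℕ → Set
Oracle n d = Fin n → Vec (Maybe (Subset n)) d

Represents : ∀ {n d} → Oracle n d → Hypergraph n → Set
Represents {n} {d} A E =
    (∀ i e → E e ≡ true → i ∈ e → ∃ λ j → lookup (A i) j ≡ just e)
  × (∀ i j e → lookup (A i) j ≡ just e → E e ≡ true × i ∈ e)
  × (∀ i j j' e → lookup (A i) j ≡ just e → lookup (A i) j' ≡ just e → j ≡ j')
  × (∀ i (j j' : Fin d) → toℕ j < toℕ j' → lookup (A i) j ≡ nothing →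
       lookup (A i) j' ≡ nothing)

countSubsets : ∀ n → (Subset n → Bool) → ℕ
countSubsets zero f = if f [] then 1 else 0
countSubsets (suc n) f = countSubsets n (λ s → f (true ∷ s))
                       + countSubsets n (λ s → f (false ∷ s))

symDiff : ∀ {n} → Hypergraph n → Hypergraph n → ℕ
symDiff {n} E₁ E₂ = countSubsets n (λ e → E₁ e xor E₂ e)

countFin : ∀ m → (Fin m → Bool) → ℕ
countFin zero f = 0
countFin (suc m) f = (if f Fin.zero then 1 else 0) + countFin m (λ x → f (Fin.suc x))

-- Deterministic adaptive query algorithms making at most q queries:
-- a query (i , j) returns the j-th entry of A_i.
data DecisionTree (n d : ℕ) : ℕ → Set where
  leaf  : ∀ {q} → Bool → DecisionTree n d q
  query : ∀ {q} → Fin n → Fin d →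
          (Maybe (Subset n) → DecisionTree n d q) → DecisionTree n d (suc q)

run : ∀ {n d q} → DecisionTree n d q → Oracle n d → Bool
run (leaf b) A = b
run (query i j k) A = run (k (lookup (A i) j)) A

-- A randomized algorithm with q queries on n-vertex inputs: a uniformly
-- random seed s from Fin (suc r) selects a deterministic decision tree.
record RandomizedTester (n d q : ℕ) : Set where
  field
    r     : ℕ
    trees : Fin (suc r) → DecisionTree n d q

open RandomizedTester public

acceptCount : ∀ {n d q} → RandomizedTester n d q → Oracle n d → ℕ
acceptCount {n} {d} {q} T A = countFin (suc (r T)) (λ s → run (trees T s) A)

numSeeds : ∀ {n d q} → RandomizedTester n d q → ℕ
numSeeds T = suc (r T)

-- ε-far from k-partiteness (in the bounded-degree-d model):
-- distance symDiff/(d n) to every k-uniform k-partite n-vertex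
-- hypergraph exceeds ε; written as ε · (d n) < symDiff.
open import Data.Rational as ℚ using (ℚ)
open import Data.Integer using (+_)

FarFromPartite : ∀ {n} → ℕ → ℕ → ℚ → Hypergraph n → Set
FarFromPartite {n} k d ε E =
  ∀ (E' : Hypergraph n) → Uniform k E' → Partite k E' →
    ε ℚ.* ((+ (d * n)) ℚ./ 1) ℚ.< ((+ symDiff E E') ℚ./ 1)

{-# OPTIONS --safe #-}
module Submission where

-- The tester samples M = 2a vertices, where a = 2D and D is the denominator of ε, and accepts when every
-- sampled vertex passes a local test: explore the ball of radius S + 1 around it through the oracle and
-- check that the hyperedges seen there admit a proper k-colouring. On k-partite inputs every vertex passes.
--
-- For soundness, mark the nodes of a width-t tree decomposition bottom-up: a node is marked once more than
-- S vertices have their topmost bag in its subtree with no other marked node in between. The bags of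
-- marked nodes cover a set X of at most (t + 1) n / (S + 1) vertices, and every component of the Gaifman
-- graph minus X has at most S vertices, so it lies in the explored ball of each of its vertices. Colouring
-- each component by a colouring found from it alone, and deleting the hyperedges that meet X or a failing
-- vertex, gives a k-partite hypergraph at distance at most d (|X| + #failing) from the input. Hence an
-- ε-far input has more than n / (a + 1) failing vertices, and all M samples pass with probability at most
-- (a / (a + 1)) ^ (2a) ≤ 1/4.

open import Defs
open import Data.Nat using (ℕ; zero; suc; pred; _+_; _*_; _∸_; _^_; _≤_; _<_; z≤n; s≤s; _<?_)
open import Data.Nat.Properties hiding (_≟_)
open import Data.Nat.GeneralisedArithmetic using (fold)
open import Data.Nat.Solver using (module +-*-Solver)
open import Algebra.Properties.Semiring.Sum +-*-semiring
  using (sum-syntax; sum-cong-≗; ∑-distrib-+; ∑-comm; *-distribˡ-sum; *-distribʳ-sum)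
open import Data.Bool using (Bool; true; false; if_then_else_; _∧_; _xor_)
open import Data.Bool.Properties using (xor-same) renaming (_≟_ to _≟ᵇ_)
open import Data.Fin using (Fin; zero; suc; toℕ; _≟_; _↑ˡ_; _↑ʳ_; combine; finToFun; funToFin; cast)
import Data.Fin.Properties as Fin
open import Data.Fin.Properties using (any?; all?; toℕ-injective; toℕ<n; finToFun-funToFin)
open import Data.Fin.Subset using (Subset; _∈_; _∉_; _⊆_; _∪_; ∁; ∣_∣; ⁅_⁆; ⊥)
open import Data.Fin.Subset.Properties
  using (_∈?_; _⊆?_; anySubset?; ∉⊥; x∈⁅x⁆; x∈⁅y⁆⇒x≡y; p⊆p∪q; q⊆p∪q; x∈∁p⇒x∉p; x∉p⇒x∈∁p; ⊆-antisym;
         p⊆q⇒∣p∣≤∣q∣; p⊂q⇒∣p∣<∣q∣; ∣p∣≤n; ∣⊥∣≡0; ∣⁅x⁆∣≡1; ∣∁p∣≡n∸∣p∣)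
open import Data.Maybe using (Maybe; just; nothing; fromMaybe)
import Data.Maybe.Properties as Maybe
open import Data.Maybe.Relation.Unary.All as All using (All; just; nothing; drop-just)
open import Data.Vec using (Vec; []; _∷_; lookup; tabulate; replicate)
import Data.Vec.Properties as Vec
open import Data.Vec.Properties
  using (lookup∘tabulate; tabulate∘lookup; tabulate-cong; lookup-replicate; []=⇒lookup; lookup⇒[]=; ∷-injectiveʳ)
open import Data.Product using (Σ; ∃; _×_; _,_; proj₁; proj₂)
open import Data.Sum using (_⊎_; inj₁; inj₂)
open import Data.Empty using (⊥-elim)
import Data.Integer as ℤ
import Data.Integer.Properties as ℤ
open import Data.Rational as ℚ using (ℚ; mkℚ; 0ℚ; 1ℚ; _/_)
import Data.Rational.Properties as ℚ
import Data.Rational.Unnormalised as ℚᵘ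
import Data.Rational.Unnormalised.Properties as ℚᵘ
open import Function using (_∘_; id; _⇔_; mk⇔; case_of_; Equivalence)
open import Relation.Nullary using (Dec; yes; no; does; ¬_; contradiction)
open import Relation.Nullary.Decidable using (_×-dec_; _⊎-dec_; _→-dec_; ¬?; dec-true; does-⇔; decidable-stable)
open import Relation.Unary using (Pred; Decidable)
open import Relation.Binary.PropositionalEquality
open +-*-Solver using (solve; _:=_; con; _:+_; _:*_)

-- Counting

χ : Bool → ℕ
χ b = if b then 1 else 0

χ≤1 : ∀ b → χ b ≤ 1
χ≤1 true  = ≤-refl
χ≤1 false = z≤n

∑-mono-≤ : ∀ {m} {f g : Fin m → ℕ} → (∀ i → f i ≤ g i) → ∑[ i < m ] f i ≤ ∑[ i < m ] g i
∑-mono-≤ {zero}  f≤g = z≤n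
∑-mono-≤ {suc m} f≤g = +-mono-≤ (f≤g zero) (∑-mono-≤ (f≤g ∘ suc))

∑-const : ∀ m c → ∑[ i < m ] c ≡ m * c
∑-const zero    c = refl
∑-const (suc m) c = cong (c +_) (∑-const m c)

≤-∑ : ∀ {m} (f : Fin m → ℕ) i → f i ≤ ∑[ j < m ] f j
≤-∑ f zero    = m≤m+n _ _
≤-∑ f (suc i) = ≤-trans (≤-∑ (f ∘ suc) i) (m≤n+m _ (f zero))

χ≤∑ : ∀ {m} b (g : Fin m → ℕ) → (b ≡ true → ∃ λ i → 1 ≤ g i) → χ b ≤ ∑[ i < m ] g i
χ≤∑ false g _ = z≤n
χ≤∑ true  g h = let i , 1≤gi = h refl in ≤-trans 1≤gi (≤-∑ g i)

∑χ≤1 : ∀ {m} (f : Fin m → Bool) → (∀ {i j} → f i ≡ true → f j ≡ true → i ≡ j) →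
       ∑[ i < m ] χ (f i) ≤ 1
∑χ≤1 {zero}  f unique = z≤n
∑χ≤1 {suc m} f unique with f zero in f0
... | true  = s≤s (≤-trans (∑-mono-≤ (λ i → ≤-reflexive (cong χ (rest≡false i))))
                          (≤-reflexive (trans (∑-const m 0) (*-zeroʳ m))))
  where
  rest≡false : ∀ i → f (suc i) ≡ false
  rest≡false i with f (suc i) in fi
  ... | true  with () ← unique f0 fi
  ... | false = refl
... | false = ∑χ≤1 (f ∘ suc) λ fi fj → Fin.suc-injective (unique fi fj)

countFin≡∑χ : ∀ m (f : Fin m → Bool) → countFin m f ≡ ∑[ i < m ] χ (f i)
countFin≡∑χ zero    f = refl
countFin≡∑χ (suc m) f = cong (χ (f zero) +_) (countFin≡∑χ m (f ∘ suc))

does≡true⇒ : ∀ {p} {P : Set p} (P? : Dec P) → does P? ≡ true → P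
does≡true⇒ (yes p) _ = p

does≡false⇒ : ∀ {p} {P : Set p} (P? : Dec P) → does P? ≡ false → ¬ P
does≡false⇒ (no ¬p) _ = ¬p

subsetOf : ∀ {n ℓ} {P : Pred (Fin n) ℓ} → Decidable P → Subset n
subsetOf P? = tabulate (does ∘ P?)

module _ {n ℓ} {P : Pred (Fin n) ℓ} (P? : Decidable P) where

  ∈-subsetOf⁺ : ∀ {x} → P x → x ∈ subsetOf P?
  ∈-subsetOf⁺ {x} px = lookup⇒[]= x _ (trans (lookup∘tabulate _ x) (dec-true (P? x) px))

  ∈-subsetOf⁻ : ∀ {x} → x ∈ subsetOf P? → P x
  ∈-subsetOf⁻ {x} x∈ with P? x | trans (sym (lookup∘tabulate (does ∘ P?) x)) ([]=⇒lookup x∈)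
  ... | yes px | _ = px

∣p∣≡∑χ : ∀ {n} (p : Subset n) → ∣ p ∣ ≡ ∑[ x < n ] χ (lookup p x)
∣p∣≡∑χ []          = refl
∣p∣≡∑χ (true ∷ p)  = cong suc (∣p∣≡∑χ p)
∣p∣≡∑χ (false ∷ p) = ∣p∣≡∑χ p

∣tabulate∣≡∑χ : ∀ {n} (f : Fin n → Bool) → ∣ tabulate f ∣ ≡ ∑[ x < n ] χ (f x)
∣tabulate∣≡∑χ f = trans (∣p∣≡∑χ (tabulate f)) (sum-cong-≗ (cong χ ∘ lookup∘tabulate f))

∣p∪q∣≤∣p∣+∣q∣ : ∀ {n} (p q : Subset n) → ∣ p ∪ q ∣ ≤ ∣ p ∣ + ∣ q ∣
∣p∪q∣≤∣p∣+∣q∣ []          []          = z≤n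
∣p∪q∣≤∣p∣+∣q∣ (true ∷ p)  (true ∷ q)  = s≤s (≤-trans (∣p∪q∣≤∣p∣+∣q∣ p q) (+-monoʳ-≤ ∣ p ∣ (n≤1+n ∣ q ∣)))
∣p∪q∣≤∣p∣+∣q∣ (true ∷ p)  (false ∷ q) = s≤s (∣p∪q∣≤∣p∣+∣q∣ p q)
∣p∪q∣≤∣p∣+∣q∣ (false ∷ p) (true ∷ q)  = ≤-trans (s≤s (∣p∪q∣≤∣p∣+∣q∣ p q)) (≤-reflexive (sym (+-suc ∣ p ∣ ∣ q ∣)))
∣p∪q∣≤∣p∣+∣q∣ (false ∷ p) (false ∷ q) = ∣p∪q∣≤∣p∣+∣q∣ p q

module _ {m n} (p : Fin m → Subset n) where

  union-bound : ∀ {q : Subset n} → (∀ {x} → x ∈ q → ∃ λ i → x ∈ p i) → ∣ q ∣ ≤ ∑[ i < m ] ∣ p i ∣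
  union-bound {q} cover = begin
    ∣ q ∣                                          ≡⟨ ∣p∣≡∑χ q ⟩
    ∑[ x < n ] χ (lookup q x)                      ≤⟨ ∑-mono-≤ pointwise ⟩
    ∑[ x < n ] ∑[ i < m ] χ (lookup (p i) x)       ≡⟨ ∑-comm (λ x i → χ (lookup (p i) x)) ⟩
    ∑[ i < m ] ∑[ x < n ] χ (lookup (p i) x)       ≡⟨ sum-cong-≗ (sym ∘ ∣p∣≡∑χ ∘ p) ⟩
    ∑[ i < m ] ∣ p i ∣                             ∎
    where
    open ≤-Reasoning
    pointwise : ∀ x → χ (lookup q x) ≤ ∑[ i < m ] χ (lookup (p i) x)
    pointwise x = χ≤∑ _ _ λ qx → let i , x∈pi = cover (lookup⇒[]= x q qx)
                                  in i , ≤-reflexive (cong χ (sym ([]=⇒lookup x∈pi)))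

  disjoint-bound : (∀ {x i j} → x ∈ p i → x ∈ p j → i ≡ j) → ∑[ i < m ] ∣ p i ∣ ≤ n
  disjoint-bound disjoint = begin
    ∑[ i < m ] ∣ p i ∣                             ≡⟨ sum-cong-≗ (∣p∣≡∑χ ∘ p) ⟩
    ∑[ i < m ] ∑[ x < n ] χ (lookup (p i) x)       ≡⟨ ∑-comm (λ i x → χ (lookup (p i) x)) ⟩
    ∑[ x < n ] ∑[ i < m ] χ (lookup (p i) x)       ≤⟨ ∑-mono-≤ (λ x → ∑χ≤1 _ λ pix pjx →
                                                        disjoint (lookup⇒[]= x _ pix) (lookup⇒[]= x _ pjx)) ⟩
    ∑[ x < n ] 1                                   ≡⟨ trans (∑-const n 1) (*-identityʳ n) ⟩
    n                                              ∎
    where open ≤-Reasoning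

countSubsets-union-bound : ∀ n {m} {f : Subset n → Bool} (g : Fin m → Subset n → Bool) →
  (∀ e → f e ≡ true → ∃ λ i → g i e ≡ true) → countSubsets n f ≤ ∑[ i < m ] countSubsets n (g i)
countSubsets-union-bound zero {f = f} g cover =
  χ≤∑ (f []) _ λ f[] → let i , gi[] = cover [] f[] in i , ≤-reflexive (cong χ (sym gi[]))
countSubsets-union-bound (suc n) g cover = ≤-trans
  (+-mono-≤ (countSubsets-union-bound n (λ i e → g i (true ∷ e)) (cover ∘ (true ∷_)))
            (countSubsets-union-bound n (λ i e → g i (false ∷ e)) (cover ∘ (false ∷_))))
  (≤-reflexive (sym (∑-distrib-+ (λ i → countSubsets n (λ e → g i (true ∷ e)))
                                (λ i → countSubsets n (λ e → g i (false ∷ e))))))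

countSubsets-false : ∀ n {f : Subset n → Bool} → (∀ e → f e ≡ false) → countSubsets n f ≡ 0
countSubsets-false zero    f≡false rewrite f≡false [] = refl
countSubsets-false (suc n) f≡false =
  cong₂ _+_ (countSubsets-false n (f≡false ∘ (true ∷_))) (countSubsets-false n (f≡false ∘ (false ∷_)))

countSubsets-≤1 : ∀ n {f : Subset n → Bool} (e₀ : Subset n) → (∀ e → f e ≡ true → e ≡ e₀) →
                  countSubsets n f ≤ 1
countSubsets-≤1 zero    {f} [] _ = χ≤1 (f [])
countSubsets-≤1 (suc n) {f} (true ∷ e₀) only =
  +-mono-≤ (countSubsets-≤1 n e₀ λ e fe → ∷-injectiveʳ (only _ fe)) (≤-reflexive (countSubsets-false n off))
  where
  off : ∀ e → f (false ∷ e) ≡ false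
  off e with f (false ∷ e) in fe
  ... | true with () ← only _ fe
  ... | false = refl
countSubsets-≤1 (suc n) {f} (false ∷ e₀) only =
  +-mono-≤ (≤-reflexive (countSubsets-false n off)) (countSubsets-≤1 n e₀ λ e fe → ∷-injectiveʳ (only _ fe))
  where
  off : ∀ e → f (true ∷ e) ≡ false
  off e with f (true ∷ e) in fe
  ... | true with () ← only _ fe
  ... | false = refl

∈-if-⊥ : ∀ {n} b {p : Subset n} {x} → x ∈ (if b then p else ⊥) → b ≡ true × x ∈ p
∈-if-⊥ true  x∈p = refl , x∈p
∈-if-⊥ false x∈⊥ = ⊥-elim (∉⊥ x∈⊥)

∑-cast : ∀ {m m′} (eq : m ≡ m′) (f : Fin m′ → ℕ) → ∑[ s < m ] f (cast eq s) ≡ ∑[ s < m′ ] f s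
∑-cast refl f = sum-cong-≗ (cong f ∘ Fin.cast-is-id refl)

∑-↑ : ∀ a b (f : Fin (a + b) → ℕ) → ∑[ s < a + b ] f s ≡ ∑[ i < a ] f (i ↑ˡ b) + ∑[ j < b ] f (a ↑ʳ j)
∑-↑ zero    b f = refl
∑-↑ (suc a) b f = trans (cong (f zero +_) (∑-↑ a b (f ∘ suc))) (sym (+-assoc (f zero) _ _))

∑-combine : ∀ a b (f : Fin (a * b) → ℕ) → ∑[ s < a * b ] f s ≡ ∑[ i < a ] ∑[ j < b ] f (combine i j)
∑-combine zero    b f = refl
∑-combine (suc a) b f =
  trans (∑-↑ b (a * b) f) (cong (∑[ j < b ] f (j ↑ˡ (a * b)) +_) (∑-combine a b (f ∘ (b ↑ʳ_))))

χ-∧ : ∀ x y → χ (x ∧ y) ≡ χ x * χ y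
χ-∧ true  y = sym (+-identityʳ (χ y))
χ-∧ false y = refl

allᵇ : ∀ {n m} → (Fin n → Bool) → (Fin m → Fin n) → Bool
allᵇ {m = zero}  f vs = true
allᵇ {m = suc m} f vs = f (vs zero) ∧ allᵇ f (vs ∘ suc)

-- finToFun is a bijection from Fin (n ^ M) onto the M-tuples of vertices.
count-tuples : ∀ {n} M (f : Fin n → Bool) →
               ∑[ s < n ^ M ] χ (allᵇ f (finToFun {n} {M} s)) ≡ (∑[ i < n ] χ (f i)) ^ M
count-tuples         zero    f = refl
count-tuples {n = n} (suc M) f = begin
  ∑[ s < n * n ^ M ] χ (all (suc M) s)                     ≡⟨ ∑-combine n (n ^ M) (χ ∘ all (suc M)) ⟩
  ∑[ i < n ] ∑[ j < n ^ M ] χ (all (suc M) (combine i j))   ≡⟨ sum-cong-≗ (λ i → sum-cong-≗ (split i)) ⟩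
  ∑[ i < n ] ∑[ j < n ^ M ] (χ (f i) * χ (all M j))         ≡⟨ sum-cong-≗ (λ i → *-distribˡ-sum (χ (f i)) (χ ∘ all M)) ⟨
  ∑[ i < n ] (χ (f i) * ∑[ j < n ^ M ] χ (all M j))         ≡⟨ sum-cong-≗ (λ i → cong (χ (f i) *_) (count-tuples M f)) ⟩
  ∑[ i < n ] (χ (f i) * G ^ M)                              ≡⟨ *-distribʳ-sum (G ^ M) (χ ∘ f) ⟨
  G * G ^ M                                                 ∎
  where
  open ≡-Reasoning
  G = ∑[ i < n ] χ (f i)
  all : ∀ M → Fin (n ^ M) → Bool
  all M s = allᵇ f (finToFun {n} {M} s)
  split : ∀ i j → χ (all (suc M) (combine i j)) ≡ χ (f i) * χ (all M j)
  split i j = trans (cong (λ ij → χ (f (proj₁ ij) ∧ all M (proj₂ ij))) (Fin.remQuot-combine i j)) (χ-∧ (f i) (all M j))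

-- Tree decompositions and small separators

least : ∀ {m ℓ} {P : Pred (Fin m) ℓ} → Decidable P → ∃ P → ∃ λ x → P x × (∀ {y} → P y → toℕ x ≤ toℕ y)
least {suc m} {P = P} P? (x , px) with P? zero
... | yes p0 = zero , p0 , λ _ → z≤n
... | no ¬p0 with least (P? ∘ suc) (shift x px)
  where
  shift : ∀ x → P x → ∃ (P ∘ suc)
  shift zero    p0 = contradiction p0 ¬p0
  shift (suc x) px = x , px
...   | x′ , px′ , min = suc x′ , px′ , λ { {zero} p0 → contradiction p0 ¬p0 ; {suc y} py → s≤s (min py) }

module Subtrees {m} (T : RootedTree m) where

  Node : Set
  Node = Fin (suc m)

  infix 4 _≼_ _≼?_

  -- x ≼ y : y lies in the subtree rooted at x
  data _≼_ (x : Node) : Node → Set where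
    ≼-refl  : x ≼ x
    ≼-child : ∀ {j} → x ≼ par T j → x ≼ suc j

  ≼⇒≤ : ∀ {x y} → x ≼ y → toℕ x ≤ toℕ y
  ≼⇒≤ ≼-refl            = ≤-refl
  ≼⇒≤ (≼-child {j} x≼p) = ≤-trans (≼⇒≤ x≼p) (≤-trans (par-ord T j) (n≤1+n _))

  ≼∧≢⇒< : ∀ {x y} → x ≼ y → x ≢ y → toℕ x < toℕ y
  ≼∧≢⇒< x≼y x≢y = ≤∧≢⇒< (≼⇒≤ x≼y) (x≢y ∘ toℕ-injective)

  ≼-antisym : ∀ {x y} → x ≼ y → y ≼ x → x ≡ y
  ≼-antisym x≼y y≼x = toℕ-injective (≤-antisym (≼⇒≤ x≼y) (≼⇒≤ y≼x))

  ≼-trans : ∀ {x y z} → x ≼ y → y ≼ z → x ≼ z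
  ≼-trans x≼y ≼-refl        = x≼y
  ≼-trans x≼y (≼-child y≼p) = ≼-child (≼-trans x≼y y≼p)

  ≼-linear : ∀ {x y z} → x ≼ z → y ≼ z → x ≼ y ⊎ y ≼ x
  ≼-linear ≼-refl        y≼z           = inj₂ y≼z
  ≼-linear (≼-child x≼p) ≼-refl        = inj₁ (≼-child x≼p)
  ≼-linear (≼-child x≼p) (≼-child y≼p) = ≼-linear x≼p y≼p

  ≼-root : ∀ {x} → x ≼ zero → x ≡ zero
  ≼-root ≼-refl = refl

  _≼?_ : ∀ x y → Dec (x ≼ y)
  x ≼? y = search (suc (toℕ y)) y ≤-refl
    where
    search : ∀ fuel y → toℕ y < fuel → Dec (x ≼ y)
    search (suc fuel) y y<fuel with x ≟ y
    ... | yes refl = yes ≼-refl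
    search (suc fuel) zero    _           | no x≢y = no λ { ≼-refl → x≢y refl }
    search (suc fuel) (suc j) (s≤s j<fuel) | no x≢y with search fuel (par T j) (≤-<-trans (par-ord T j) j<fuel)
    ... | yes x≼p = yes (≼-child x≼p)
    ... | no x⋠p  = no λ { ≼-refl → x≢y refl ; (≼-child x≼p) → x⋠p x≼p }

  reach-source : ∀ {P : Node → Set} {a b} → ReachIn T P a b → P a
  reach-source (here pa)     = pa
  reach-source (step pa _ _) = pa

  exit-subtree : ∀ {P : Node → Set} {a b c} → ReachIn T P a b → c ≼ a → ¬ c ≼ b →
                 P c × ∃ λ j → c ≡ suc j × P (par T j)
  exit-subtree (here _) c≼a c⋠b = contradiction c≼a c⋠b
  exit-subtree {c = c} (step {b = a′} pa adj walk) c≼a c⋠b with c ≼? a′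
  ... | yes c≼a′ = exit-subtree walk c≼a′ c⋠b
  ... | no c⋠a′ with adj
  ...   | inj₂ (j , refl , refl) = contradiction (≼-child c≼a) c⋠a′
  ...   | inj₁ (j , refl , refl) with c≼a
  ...     | ≼-refl      = pa , j , refl , reach-source walk
  ...     | ≼-child c≼p = contradiction c≼p c⋠a′

record SmallComponents {n} (E : Hypergraph n) (X : Subset n) (S : ℕ) : Set where
  field
    cell        : Fin n → Subset n
    cell-self   : ∀ {v} → v ∉ X → v ∈ cell v
    cell-closed : ∀ {v u w} → u ∈ cell v → w ∉ X → GaifmanAdj E u w → w ∈ cell v
    cell-small  : ∀ v → ∣ cell v ∣ ≤ S

module Separator {n t} {E : Hypergraph n} (TD : TreeDecomposition E t) (S : ℕ) where
  open TreeDecomposition TD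
  open Subtrees tree

  private
    topSpec : ∀ u → ∃ λ x → u ∈ bag x × (∀ {y} → u ∈ bag y → toℕ x ≤ toℕ y)
    topSpec u = least (λ x → u ∈? bag x) (vcover u)

  top : Fin n → Node
  top u = proj₁ (topSpec u)

  top-∈ : ∀ u → u ∈ bag (top u)
  top-∈ u = proj₁ (proj₂ (topSpec u))

  top-≼ : ∀ {u y} → u ∈ bag y → top u ≼ y
  top-≼ {u} {y} u∈y with top u ≼? y
  ... | yes top≼y = top≼y
  ... | no top⋠y with exit-subtree (connected u (top u) y (top-∈ u) u∈y) ≼-refl top⋠y
  ...   | _ , j , top≡ , u∈p = contradiction (proj₂ (proj₂ (topSpec u)) u∈p)
                                  (<⇒≱ (subst (λ x → toℕ (par tree j) < toℕ x) (sym top≡) (s≤s (par-ord tree j))))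

  Owned : (Node → Bool) → Node → Fin n → Set
  Owned M x u = x ≼ top u × (∀ z → M z ≡ true → x ≼ z → z ≼ top u → z ≡ x)

  owned? : ∀ M x → Decidable (Owned M x)
  owned? M x u = (x ≼? top u) ×-dec all? λ z → (M z ≟ᵇ true) →-dec (x ≼? z) →-dec (z ≼? top u) →-dec (z ≟ x)

  owned : (Node → Bool) → Node → Subset n
  owned M x = subsetOf (owned? M x)

  owned-local : ∀ {M M′} x → (∀ z → x ≼ z → z ≢ x → M z ≡ M′ z) → owned M x ≡ owned M′ x
  owned-local x agree = tabulate-cong λ u →
    does-⇔ (mk⇔ (transfer {u = u} agree) (transfer {u = u} λ z x≼z z≢x → sym (agree z x≼z z≢x)))
           (owned? _ x u) (owned? _ x u)
    where
    transfer : ∀ {M M′ u} → (∀ z → x ≼ z → z ≢ x → M z ≡ M′ z) → Owned M x u → Owned M′ x u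
    transfer agree (x≼u , only) = x≼u , λ z M′z x≼z z≼u → case z ≟ x of λ where
      (yes z≡x) → z≡x
      (no z≢x)  → only z (trans (agree z x≼z z≢x) M′z) x≼z z≼u

  markStep : (Node → Bool) → Node → Bool
  markStep M x = does (S <? ∣ owned M x ∣)

  marks : ℕ → Node → Bool
  marks = fold (λ _ → false) markStep

  -- The mark of x only depends on the marks strictly below x, so marks stabilise from the leaves up.
  marks-stable : ∀ i x → m ∸ toℕ x < i → marks i x ≡ marks (suc i) x
  marks-stable (suc i) x (s≤s m∸x≤i) = cong (λ p → does (S <? ∣ p ∣)) (owned-local x λ z x≼z z≢x →
    marks-stable i z (<-≤-trans (∸-monoʳ-< (≼∧≢⇒< x≼z (z≢x ∘ sym)) (≤-pred (toℕ<n z))) m∸x≤i))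

  marked : Node → Bool
  marked = marks (suc m)

  marked-fixed : ∀ x → marked x ≡ markStep marked x
  marked-fixed x = marks-stable (suc m) x (s≤s (m∸n≤m m (toℕ x)))

  marked⇒large : ∀ {x} → marked x ≡ true → S < ∣ owned marked x ∣
  marked⇒large {x} mx = does≡true⇒ (S <? _) (trans (sym (marked-fixed x)) mx)

  unmarked⇒small : ∀ {x} → marked x ≡ false → ∣ owned marked x ∣ ≤ S
  unmarked⇒small {x} mx = ≮⇒≥ (does≡false⇒ (S <? _) (trans (sym (marked-fixed x)) mx))

  owner-unique : ∀ {x x′ u} → marked x ≡ true → marked x′ ≡ true →
                 Owned marked x u → Owned marked x′ u → x ≡ x′
  owner-unique mx mx′ (x≼u , only) (x′≼u , only′) with ≼-linear x≼u x′≼u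
  ... | inj₁ x≼x′ = sym (only _ mx′ x≼x′ x′≼u)
  ... | inj₂ x′≼x = only′ _ mx x′≼x x≼u

  InMarkedBag : Fin n → Set
  InMarkedBag u = ∃ λ x → marked x ≡ true × u ∈ bag x

  inMarkedBag? : Decidable InMarkedBag
  inMarkedBag? u = any? λ x → (marked x ≟ᵇ true) ×-dec (u ∈? bag x)

  X : Subset n
  X = subsetOf inMarkedBag?

  ∈X⁺ : ∀ {x u} → marked x ≡ true → u ∈ bag x → u ∈ X
  ∈X⁺ {x} mx u∈x = ∈-subsetOf⁺ inMarkedBag? (x , mx , u∈x)

  top-unmarked : ∀ {v} → v ∉ X → marked (top v) ≡ false
  top-unmarked {v} v∉X with marked (top v) in mt
  ... | true  = contradiction (∈X⁺ mt (top-∈ v)) v∉X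
  ... | false = refl

  climb : ∀ fuel (y : Node) → toℕ y < fuel → Node
  climb (suc fuel) zero    _            = zero
  climb (suc fuel) (suc j) (s≤s j<fuel) =
    if marked (par tree j) then suc j else climb fuel (par tree j) (≤-<-trans (par-ord tree j) j<fuel)

  climb-≼ : ∀ fuel y y<fuel → climb fuel y y<fuel ≼ y
  climb-≼ (suc fuel) zero    _            = ≼-refl
  climb-≼ (suc fuel) (suc j) (s≤s j<fuel) with marked (par tree j)
  ... | true  = ≼-refl
  ... | false = ≼-child (climb-≼ fuel (par tree j) _)

  climb-stops : ∀ fuel y y<fuel → let c = climb fuel y y<fuel in
                c ≡ zero ⊎ ∃ λ j → c ≡ suc j × marked (par tree j) ≡ true
  climb-stops (suc fuel) zero    _            = inj₁ refl
  climb-stops (suc fuel) (suc j) (s≤s j<fuel) with marked (par tree j) in mp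
  ... | true  = inj₂ (j , refl , mp)
  ... | false = climb-stops fuel (par tree j) _

  climb-unmarked : ∀ fuel y y<fuel → marked y ≡ false →
                   ∀ {z} → climb fuel y y<fuel ≼ z → z ≼ y → marked z ≡ false
  climb-unmarked (suc fuel) zero    _            my c≼z z≼y = subst (λ z → marked z ≡ false) (sym (≼-root z≼y)) my
  climb-unmarked (suc fuel) (suc j) (s≤s j<fuel) my c≼z z≼y with marked (par tree j) in mp
  ... | true  = subst (λ z → marked z ≡ false) (≼-antisym c≼z z≼y) my
  climb-unmarked (suc fuel) (suc j) (s≤s j<fuel) my c≼z ≼-refl        | false = my
  climb-unmarked (suc fuel) (suc j) (s≤s j<fuel) my c≼z (≼-child z≼p) | false =
    climb-unmarked fuel (par tree j) _ mp c≼z z≼p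

  anchor : Fin n → Node
  anchor v = climb (suc m) (top v) (toℕ<n (top v))

  anchor-≼ : ∀ v → anchor v ≼ top v
  anchor-≼ v = climb-≼ (suc m) (top v) (toℕ<n (top v))

  anchor-stops : ∀ v → anchor v ≡ zero ⊎ ∃ λ j → anchor v ≡ suc j × marked (par tree j) ≡ true
  anchor-stops v = climb-stops (suc m) (top v) (toℕ<n (top v))

  anchor-path-unmarked : ∀ {v z} → v ∉ X → anchor v ≼ z → z ≼ top v → marked z ≡ false
  anchor-path-unmarked {v} v∉X = climb-unmarked (suc m) (top v) (toℕ<n (top v)) (top-unmarked v∉X)

  InCell : Node → Fin n → Set
  InCell c u = u ∉ X × c ≼ top u × (∀ z → marked z ≡ true → c ≼ z → ¬ z ≼ top u)

  inCell? : ∀ c → Decidable (InCell c)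
  inCell? c u = ¬? (u ∈? X) ×-dec (c ≼? top u) ×-dec
                all? λ z → (marked z ≟ᵇ true) →-dec (c ≼? z) →-dec ¬? (z ≼? top u)

  inCell-anchor : ∀ {v} → v ∉ X → InCell (anchor v) v
  inCell-anchor {v} v∉X = v∉X , anchor-≼ v , λ z mz a≼z z≼top →
    contradiction (trans (sym mz) (anchor-path-unmarked v∉X a≼z z≼top)) λ ()

  inCell⇒owned : ∀ {c u} → InCell c u → Owned marked c u
  inCell⇒owned (_ , c≼u , avoid) = c≼u , λ z mz c≼z z≼u → contradiction z≼u (avoid z mz c≼z)

  -- By connectivity, a vertex with bags on both sides of a marked node z lies in bag z, hence in X.
  inCell-closed : ∀ {v u w y} → InCell (anchor v) u → w ∉ X → u ∈ bag y → w ∈ bag y → InCell (anchor v) w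
  inCell-closed {v} {u} {w} {y} (u∉X , a≼u , avoid) w∉X u∈y w∈y = w∉X , a≼w , avoid′
    where
    a≼y : anchor v ≼ y
    a≼y = ≼-trans a≼u (top-≼ u∈y)

    a≼w : anchor v ≼ top w
    a≼w with anchor v ≼? top w
    ... | yes a≼w = a≼w
    ... | no a⋠w with exit-subtree (connected w y (top w) w∈y (top-∈ w)) a≼y a⋠w | anchor-stops v
    ...   | _ , j , a≡ , _   | inj₁ a≡0 = contradiction (trans (sym a≡0) a≡) λ ()
    ...   | _ , j , a≡ , w∈p | inj₂ (j′ , a≡′ , mp) with trans (sym a≡) a≡′
    ...     | refl = contradiction (∈X⁺ mp w∈p) w∉X

    avoid′ : ∀ z → marked z ≡ true → anchor v ≼ z → ¬ z ≼ top w
    avoid′ z mz a≼z z≼w with z ≼? y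
    ... | yes z≼y = contradiction (∈X⁺ mz (proj₁ (exit-subtree (connected u y (top u) u∈y (top-∈ u)) z≼y
                                                              (avoid z mz a≼z)))) u∉X
    ... | no z⋠y  = contradiction (∈X⁺ mz (proj₁ (exit-subtree (connected w (top w) y (top-∈ w) w∈y) z≼w z⋠y)))
                                 w∉X

  cell? : ∀ v → Decidable λ u → v ∉ X × InCell (anchor v) u
  cell? v u = ¬? (v ∈? X) ×-dec inCell? (anchor v) u

  cell : Fin n → Subset n
  cell v = subsetOf (cell? v)

  ∈cell⁻ : ∀ v {u} → u ∈ cell v → v ∉ X × InCell (anchor v) u
  ∈cell⁻ v = ∈-subsetOf⁻ (cell? v)

  ∈cell⁺ : ∀ {v u} → v ∉ X → InCell (anchor v) u → u ∈ cell v
  ∈cell⁺ {v} v∉X inU = ∈-subsetOf⁺ (cell? v) (v∉X , inU)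

  cell-small : ∀ v → ∣ cell v ∣ ≤ S
  cell-small v = by-cases (v ∈? X)
    where
    by-cases : Dec (v ∈ X) → ∣ cell v ∣ ≤ S
    by-cases (yes v∈X) = ≤-trans (p⊆q⇒∣p∣≤∣q∣ {q = ⊥} λ u∈cell → contradiction v∈X (proj₁ (∈cell⁻ v u∈cell)))
                                 (≤-trans (≤-reflexive (∣⊥∣≡0 n)) z≤n)
    by-cases (no v∉X)  = ≤-trans (p⊆q⇒∣p∣≤∣q∣ λ u∈cell → ∈-subsetOf⁺ (owned? marked (anchor v))
                                                              (inCell⇒owned (proj₂ (∈cell⁻ v u∈cell))))
                                 (unmarked⇒small {anchor v} (anchor-path-unmarked {v} v∉X ≼-refl (anchor-≼ v)))

  smallComponents : SmallComponents E X S
  smallComponents = record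
    { cell        = cell
    ; cell-self   = λ v∉X → ∈cell⁺ v∉X (inCell-anchor v∉X)
    ; cell-closed = λ {v} u∈cell w∉X adj → let v∉X , inU = ∈cell⁻ v u∈cell ; y , u∈y , w∈y = ecover _ _ adj
                                        in ∈cell⁺ v∉X (inCell-closed {v} inU w∉X u∈y w∈y)
    ; cell-small  = cell-small
    }

  #marked : ℕ
  #marked = ∑[ x < suc m ] χ (marked x)

  marked-count : suc S * #marked ≤ n
  marked-count = begin
    suc S * #marked                          ≡⟨ *-distribˡ-sum (suc S) (χ ∘ marked) ⟩
    ∑[ x < suc m ] (suc S * χ (marked x))    ≤⟨ ∑-mono-≤ large ⟩
    ∑[ x < suc m ] ∣ markedOwned x ∣         ≤⟨ disjoint-bound markedOwned disjoint ⟩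
    n                                        ∎
    where
    open ≤-Reasoning
    markedOwned : Node → Subset n
    markedOwned x = if marked x then owned marked x else ⊥

    large : ∀ x → suc S * χ (marked x) ≤ ∣ markedOwned x ∣
    large x with marked x in mx
    ... | true  = ≤-trans (≤-reflexive (*-identityʳ (suc S))) (marked⇒large {x} mx)
    ... | false = ≤-trans (≤-reflexive (*-zeroʳ (suc S))) z≤n

    disjoint : ∀ {u x x′} → u ∈ markedOwned x → u ∈ markedOwned x′ → x ≡ x′
    disjoint {u} {x} {x′} u∈x u∈x′ =
      let mx  , u∈ox  = ∈-if-⊥ (marked x) u∈x
          mx′ , u∈ox′ = ∈-if-⊥ (marked x′) u∈x′
      in owner-unique {u = u} mx mx′ (∈-subsetOf⁻ (owned? marked x) u∈ox) (∈-subsetOf⁻ (owned? marked x′) u∈ox′)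

  X-covered : ∣ X ∣ ≤ #marked * suc t
  X-covered = begin
    ∣ X ∣                                    ≤⟨ union-bound markedBag covered ⟩
    ∑[ x < suc m ] ∣ markedBag x ∣           ≤⟨ ∑-mono-≤ small ⟩
    ∑[ x < suc m ] (χ (marked x) * suc t)    ≡⟨ *-distribʳ-sum (suc t) (χ ∘ marked) ⟨
    #marked * suc t                          ∎
    where
    open ≤-Reasoning
    markedBag : Node → Subset n
    markedBag x = if marked x then bag x else ⊥

    covered : ∀ {u} → u ∈ X → ∃ λ x → u ∈ markedBag x
    covered {u} u∈X = let x , mx , u∈x = ∈-subsetOf⁻ inMarkedBag? u∈X
                      in x , subst (λ b → u ∈ (if b then bag x else ⊥)) (sym mx) u∈x

    small : ∀ x → ∣ markedBag x ∣ ≤ χ (marked x) * suc t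
    small x with marked x
    ... | true  = ≤-trans (width x) (≤-reflexive (sym (+-identityʳ _)))
    ... | false = ≤-reflexive (∣⊥∣≡0 n)

  X-small : suc S * ∣ X ∣ ≤ suc t * n
  X-small = begin
    suc S * ∣ X ∣                 ≤⟨ *-monoʳ-≤ (suc S) X-covered ⟩
    suc S * (#marked * suc t)     ≡⟨ *-assoc (suc S) #marked (suc t) ⟨
    suc S * #marked * suc t       ≡⟨ *-comm _ (suc t) ⟩
    suc t * (suc S * #marked)     ≤⟨ *-monoʳ-≤ (suc t) marked-count ⟩
    suc t * n                     ∎
    where open ≤-Reasoning

separator : ∀ {n t} {E : Hypergraph n} → TreeDecomposition E t → ∀ S →
            Σ (Subset n) λ X → suc S * ∣ X ∣ ≤ suc t * n × SmallComponents E X S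
separator TD S = X , X-small , smallComponents
  where open Separator TD S

-- Balls in hypergraphs

module _ {n} {f g : Subset n → Subset n} where

  fold-⊆ : (∀ {p q} → p ⊆ q → f p ⊆ g q) → ∀ {p q} r → p ⊆ q → fold p f r ⊆ fold q g r
  fold-⊆ sim zero    p⊆q = p⊆q
  fold-⊆ sim (suc r) p⊆q = sim (fold-⊆ sim r p⊆q)

module Inflationary {n} (f : Subset n → Subset n) (inflate : ∀ {p} → p ⊆ f p) where

  closed-forever : ∀ {p i} → f (fold p f i) ⊆ fold p f i → ∀ l → fold p f (l + i) ≡ fold p f i
  closed-forever closed zero    = refl
  closed-forever closed (suc l) = trans (cong f (closed-forever closed l)) (⊆-antisym closed inflate)

  -- Every step adds an element until some iterate is closed.
  growth : ∀ p j → (∃ λ i → i ≤ j × f (fold p f i) ⊆ fold p f i) ⊎ j ≤ ∣ fold p f j ∣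
  growth p zero = inj₂ z≤n
  growth p (suc j) with growth p j
  ... | inj₁ (i , i≤j , closed) = inj₁ (i , m≤n⇒m≤1+n i≤j , closed)
  ... | inj₂ j≤size with any? (λ x → (x ∈? f (fold p f j)) ×-dec ¬? (x ∈? fold p f j))
  ...   | yes (x , x∈new , x∉old) = inj₂ (≤-trans (s≤s j≤size) (p⊂q⇒∣p∣<∣q∣ (inflate , x , x∈new , x∉old)))
  ...   | no ¬new = inj₁ (j , n≤1+n j , λ {x} x∈new →
                          decidable-stable (x ∈? fold p f j) λ x∉old → ¬new (x , x∈new , x∉old))

  fold-closed : ∀ {p} b → (∀ r → ∣ fold p f r ∣ ≤ b) → f (fold p f (suc b)) ⊆ fold p f (suc b)
  fold-closed {p} b bounded with growth p (suc b)
  ... | inj₂ large = contradiction (≤-trans large (bounded (suc b))) 1+n≰n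
  ... | inj₁ (i , i≤ , closed) =
    subst (λ C → f C ⊆ C) (sym (trans (cong (fold p f) (sym (m∸n+n≡m i≤))) (closed-forever closed (suc b ∸ i))))
          closed

module Balls {n} (F : Hypergraph n) where

  Reached : Subset n → Fin n → Set
  Reached R w = w ∈ R ⊎ ∃ λ e → F e ≡ true × (∃ λ u → u ∈ e × u ∈ R) × w ∈ e

  reached? : ∀ R → Decidable (Reached R)
  reached? R w = (w ∈? R) ⊎-dec
    anySubset? λ e → (F e ≟ᵇ true) ×-dec any? (λ u → (u ∈? e) ×-dec (u ∈? R)) ×-dec (w ∈? e)

  expand : Subset n → Subset n
  expand R = subsetOf (reached? R)

  ∈-expand⁻ : ∀ {R w} → w ∈ expand R → Reached R w
  ∈-expand⁻ {R} = ∈-subsetOf⁻ (reached? R)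

  expand-⊇ : ∀ {R} → R ⊆ expand R
  expand-⊇ {R} w∈R = ∈-subsetOf⁺ (reached? R) (inj₁ w∈R)

  expand-edge : ∀ {R e u w} → F e ≡ true → u ∈ e → u ∈ R → w ∈ e → w ∈ expand R
  expand-edge {R} Fe u∈e u∈R w∈e = ∈-subsetOf⁺ (reached? R) (inj₂ (_ , Fe , (_ , u∈e , u∈R) , w∈e))

  expand-mono : ∀ {R R′} → R ⊆ R′ → expand R ⊆ expand R′
  expand-mono R⊆R′ w∈ with ∈-expand⁻ w∈
  ... | inj₁ w∈R                            = expand-⊇ (R⊆R′ w∈R)
  ... | inj₂ (e , Fe , (u , u∈e , u∈R) , w∈e) = expand-edge Fe u∈e (R⊆R′ u∈R) w∈e

  Closed : Subset n → Set
  Closed C = expand C ⊆ C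

  ball : Fin n → ℕ → Subset n
  ball v = fold ⁅ v ⁆ expand

  centre∈ball : ∀ v r → v ∈ ball v r
  centre∈ball v zero    = x∈⁅x⁆ v
  centre∈ball v (suc r) = expand-⊇ (centre∈ball v r)

  ball-least : ∀ {v C} → v ∈ C → Closed C → ∀ r → ball v r ⊆ C
  ball-least {v} {C} v∈C closed zero    x∈⁅v⁆ = subst (_∈ C) (sym (x∈⁅y⁆⇒x≡y v x∈⁅v⁆)) v∈C
  ball-least         v∈C closed (suc r) = closed ∘ expand-mono (ball-least v∈C closed r)

  ball-closed : ∀ v b → (∀ r → ∣ ball v r ∣ ≤ b) → Closed (ball v (suc b))
  ball-closed v = Inflationary.fold-closed expand expand-⊇

  ball-≡ : ∀ {e a b} r → F e ≡ true → a ∈ e → b ∈ e → Closed (ball a (suc r)) → Closed (ball b (suc r)) →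
           ball a (suc r) ≡ ball b (suc r)
  ball-≡ {e} {a} {b} r Fe a∈e b∈e closedᵃ closedᵇ =
    ⊆-antisym (ball-least (expand-edge Fe b∈e (centre∈ball b r) a∈e) closedᵇ (suc r))
              (ball-least (expand-edge Fe a∈e (centre∈ball a r) b∈e) closedᵃ (suc r))

-- Query programs and the local test

module Queries (n d : ℕ) where

  data Prog (R : Set) : Set where
    return : R → Prog R
    ask    : Fin n → Fin d → (Maybe (Subset n) → Prog R) → Prog R

  private variable R R′ : Set

  eval : Prog R → Oracle n d → R
  eval (return x)  A = x
  eval (ask i j k) A = eval (k (lookup (A i) j)) A

  cost : Prog R → Oracle n d → ℕ
  cost (return x)  A = 0
  cost (ask i j k) A = suc (cost (k (lookup (A i) j)) A)

  infixl 1 _>>=_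
  _>>=_ : Prog R → (R → Prog R′) → Prog R′
  return x  >>= f = f x
  ask i j k >>= f = ask i j λ a → k a >>= f

  eval->>= : ∀ (p : Prog R) (f : R → Prog R′) A → eval (p >>= f) A ≡ eval (f (eval p A)) A
  eval->>= (return x)  f A = refl
  eval->>= (ask i j k) f A = eval->>= (k _) f A

  cost->>= : ∀ (p : Prog R) (f : R → Prog R′) A → cost (p >>= f) A ≡ cost p A + cost (f (eval p A)) A
  cost->>= (return x)  f A = refl
  cost->>= (ask i j k) f A = cong suc (cost->>= (k _) f A)

  forEach : ∀ {m} → (Fin m → Prog R) → Prog (Vec R m)
  forEach {m = zero}  ps = return []
  forEach {m = suc m} ps = ps zero >>= λ x → forEach (ps ∘ suc) >>= λ xs → return (x ∷ xs)

  eval-forEach : ∀ {m} (ps : Fin m → Prog R) A → eval (forEach ps) A ≡ tabulate λ i → eval (ps i) A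
  eval-forEach {m = zero}  ps A = refl
  eval-forEach {m = suc m} ps A = begin
    eval (forEach ps) A                                    ≡⟨ eval->>= (ps zero) _ A ⟩
    eval (forEach (ps ∘ suc) >>= λ xs → return (x ∷ xs)) A ≡⟨ eval->>= (forEach (ps ∘ suc)) _ A ⟩
    x ∷ eval (forEach (ps ∘ suc)) A                        ≡⟨ cong (x ∷_) (eval-forEach (ps ∘ suc) A) ⟩
    x ∷ tabulate (λ i → eval (ps (suc i)) A)               ∎
    where
    open ≡-Reasoning
    x = eval (ps zero) A

  cost-forEach : ∀ {m} (ps : Fin m → Prog R) A → cost (forEach ps) A ≡ ∑[ i < m ] cost (ps i) A
  cost-forEach {m = zero}  ps A = refl
  cost-forEach {m = suc m} ps A = begin
    cost (forEach ps) A
      ≡⟨ cost->>= (ps zero) _ A ⟩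
    cost (ps zero) A + cost (forEach (ps ∘ suc) >>= λ xs → return (_ ∷ xs)) A
      ≡⟨ cong (cost (ps zero) A +_) (cost->>= (forEach (ps ∘ suc)) _ A) ⟩
    cost (ps zero) A + (cost (forEach (ps ∘ suc)) A + 0)
      ≡⟨ cong (cost (ps zero) A +_) (trans (+-identityʳ _) (cost-forEach (ps ∘ suc) A)) ⟩
    cost (ps zero) A + ∑[ i < m ] cost (ps (suc i)) A
      ∎
    where open ≡-Reasoning

  -- Runs exceeding the budget are cut off with the junk answer true.
  toTree : ∀ q → Prog Bool → DecisionTree n d q
  toTree q       (return b)  = leaf b
  toTree zero    (ask i j k) = leaf true
  toTree (suc q) (ask i j k) = query i j λ a → toTree q (k a)

  run-toTree : ∀ {q} (p : Prog Bool) A → cost p A ≤ q → run (toTree q p) A ≡ eval p A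
  run-toTree         (return b)  A _             = refl
  run-toTree {suc q} (ask i j k) A (s≤s cost≤q) = run-toTree (k _) A cost≤q

module _ {n d} {E : Hypergraph n} (A : Oracle n d) (rep : Represents A E) where

  listed : ∀ {u e} → E e ≡ true → u ∈ e → ∃ λ j → lookup (A u) j ≡ just e
  listed = proj₁ rep _ _

  listed-edge : ∀ {u j e} → lookup (A u) j ≡ just e → E e ≡ true
  listed-edge = proj₁ ∘ proj₁ (proj₂ rep) _ _ _

testBudget : ℕ → ℕ → ℕ → ℕ
testBudget d k rounds = suc rounds * (d * suc (d * k) ^ rounds)

module LocalTest (n d k rounds : ℕ) where
  open Queries n d

  Row : Set
  Row = Vec (Maybe (Subset n)) d

  blank : Row
  blank = replicate d nothing

  edgeIn : Maybe (Subset n) → Subset n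
  edgeIn = fromMaybe ⊥

  onRow? : ∀ row → Decidable λ w → ∃ λ (j : Fin d) → w ∈ edgeIn (lookup row j)
  onRow? row w = any? λ j → w ∈? edgeIn (lookup row j)

  rowVertices : Row → Subset n
  rowVertices row = subsetOf (onRow? row)

  touched? : ∀ (rows : Vec Row n) → Decidable λ w → ∃ λ u → w ∈ rowVertices (lookup rows u)
  touched? rows w = any? λ u → w ∈? rowVertices (lookup rows u)

  touched : Vec Row n → Subset n
  touched rows = subsetOf (touched? rows)

  -- The rows of the vertices in V, as seen by a tester that has queried exactly those rows.
  view : Oracle n d → Subset n → Vec Row n
  view A V = tabulate λ u → if lookup V u then A u else blank

  next : Oracle n d → Subset n → Subset n
  next A V = V ∪ touched (view A V)

  explored : Oracle n d → Fin n → Subset n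
  explored A v = fold ⁅ v ⁆ (next A) rounds

  -- Partite k E is Σ c (∀ e → E e ≡ true → Proper c e) by definition.
  Proper : (Fin n → Fin k) → Subset n → Set
  Proper c e = ∀ a b → a ∈ e → b ∈ e → a ≢ b → c a ≢ c b

  proper? : ∀ c → Decidable (Proper c)
  proper? c e = all? λ a → all? λ b → (a ∈? e) →-dec (b ∈? e) →-dec ¬? (a ≟ b) →-dec ¬? (c a ≟ c b)

  ColoursRows : (Fin n → Fin k) → Vec Row n → Set
  ColoursRows c rows = ∀ u j → All (Proper c) (lookup (lookup rows u) j)

  Colourable : Vec Row n → Set
  Colourable rows = ∃ λ (s : Fin (k ^ n)) → ColoursRows (finToFun s) rows

  colourable? : Decidable Colourable
  colourable? rows = any? λ s → all? λ u → all? λ j → All.dec (proper? (finToFun s)) (lookup (lookup rows u) j)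

  passes : Oracle n d → Fin n → Bool
  passes A v = does (colourable? (view A (explored A v)))

  passing : Oracle n d → Subset n
  passing A = tabulate (passes A)

  queryRow : Fin n → Prog Row
  queryRow u = forEach λ j → ask u j return

  queryRows : Subset n → Prog (Vec Row n)
  queryRows V = forEach λ u → if lookup V u then queryRow u else return blank

  grow : ℕ → Subset n → Prog (Subset n)
  grow zero    V = return V
  grow (suc r) V = grow r V >>= λ W → queryRows W >>= λ rows → return (W ∪ touched rows)

  test : Fin n → Prog Bool
  test v = grow rounds ⁅ v ⁆ >>= λ W → queryRows W >>= λ rows → return (does (colourable? rows))

  testAll : ∀ {M} → (Fin M → Fin n) → Prog Bool
  testAll {M = zero}  vs = return true
  testAll {M = suc M} vs = test (vs zero) >>= λ b → testAll (vs ∘ suc) >>= λ c → return (b ∧ c)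

  module _ (A : Oracle n d) where

    lookup-view : ∀ V u → lookup (view A V) u ≡ (if lookup V u then A u else blank)
    lookup-view V u = lookup∘tabulate _ u

    eval-queryRows : ∀ V → eval (queryRows V) A ≡ view A V
    eval-queryRows V = trans (eval-forEach _ A) (tabulate-cong row)
      where
      row : ∀ u → eval (if lookup V u then queryRow u else return blank) A ≡ (if lookup V u then A u else blank)
      row u with lookup V u
      ... | true  = trans (eval-forEach _ A) (tabulate∘lookup (A u))
      ... | false = refl

    eval-grow : ∀ r V → eval (grow r V) A ≡ fold V (next A) r
    eval-grow zero    V = refl
    eval-grow (suc r) V = begin
      eval (grow (suc r) V) A                                   ≡⟨ eval->>= (grow r V) _ A ⟩
      eval (queryRows W >>= λ rows → return (W ∪ touched rows)) A ≡⟨ eval->>= (queryRows W) _ A ⟩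
      W ∪ touched (eval (queryRows W) A)                        ≡⟨ cong (λ rows → W ∪ touched rows) (eval-queryRows W) ⟩
      next A W                                                  ≡⟨ cong (next A) (eval-grow r V) ⟩
      fold V (next A) (suc r)                                   ∎
      where
      open ≡-Reasoning
      W = eval (grow r V) A

    eval-test : ∀ v → eval (test v) A ≡ passes A v
    eval-test v = begin
      eval (test v) A
        ≡⟨ eval->>= (grow rounds ⁅ v ⁆) _ A ⟩
      eval (queryRows W >>= λ rows → return (does (colourable? rows))) A
        ≡⟨ eval->>= (queryRows W) _ A ⟩
      does (colourable? (eval (queryRows W) A))
        ≡⟨ cong (does ∘ colourable?) (eval-queryRows W) ⟩
      does (colourable? (view A W))
        ≡⟨ cong (λ W → does (colourable? (view A W))) (eval-grow rounds ⁅ v ⁆) ⟩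
      passes A v
        ∎
      where
      open ≡-Reasoning
      W = eval (grow rounds ⁅ v ⁆) A

    eval-testAll : ∀ {M} (vs : Fin M → Fin n) → eval (testAll vs) A ≡ allᵇ (passes A) vs
    eval-testAll {M = zero}  vs = refl
    eval-testAll {M = suc M} vs = begin
      eval (testAll vs) A
        ≡⟨ eval->>= (test (vs zero)) _ A ⟩
      eval (testAll (vs ∘ suc) >>= λ c → return (eval (test (vs zero)) A ∧ c)) A
        ≡⟨ eval->>= (testAll (vs ∘ suc)) _ A ⟩
      eval (test (vs zero)) A ∧ eval (testAll (vs ∘ suc)) A
        ≡⟨ cong₂ _∧_ (eval-test (vs zero)) (eval-testAll (vs ∘ suc)) ⟩
      passes A (vs zero) ∧ allᵇ (passes A) (vs ∘ suc)
        ∎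
      where open ≡-Reasoning

    cost-queryRows : ∀ V → cost (queryRows V) A ≡ ∣ V ∣ * d
    cost-queryRows V = begin
      cost (queryRows V) A                                                ≡⟨ cost-forEach _ A ⟩
      ∑[ u < n ] cost (if lookup V u then queryRow u else return blank) A ≡⟨ sum-cong-≗ row ⟩
      ∑[ u < n ] (χ (lookup V u) * d)        ≡⟨ *-distribʳ-sum d (χ ∘ lookup V) ⟨
      (∑[ u < n ] χ (lookup V u)) * d        ≡⟨ cong (_* d) (∣p∣≡∑χ V) ⟨
      ∣ V ∣ * d                              ∎
      where
      open ≡-Reasoning
      row : ∀ u → cost (if lookup V u then queryRow u else return blank) A ≡ χ (lookup V u) * d
      row u with lookup V u
      ... | true  = trans (cost-forEach _ A) (trans (∑-const d 1) (trans (*-identityʳ d) (sym (+-identityʳ d))))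
      ... | false = refl

    lookup-view-∈ : ∀ {V u} → u ∈ V → lookup (view A V) u ≡ A u
    lookup-view-∈ {V} {u} u∈V = trans (lookup-view V u) (cong (λ b → if b then A u else blank) ([]=⇒lookup u∈V))

    ColoursRowsOf : (Fin n → Fin k) → Subset n → Set
    ColoursRowsOf c V = ∀ {u} → u ∈ V → ∀ j → All (Proper c) (lookup (A u) j)

    coloursRows-view : ∀ {c} V → ColoursRows c (view A V) ⇔ ColoursRowsOf c V
    coloursRows-view {c} V = mk⇔ to from
      where
      to : ColoursRows c (view A V) → ColoursRowsOf c V
      to cols {u} u∈V j = subst (λ row → All (Proper c) (lookup row j)) (lookup-view-∈ u∈V) (cols u j)
      from : ColoursRowsOf c V → ColoursRows c (view A V)
      from cols u j rewrite lookup-view V u with lookup V u in Vu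
      ... | true  = cols (lookup⇒[]= u V Vu) j
      ... | false = subst (All (Proper c)) (sym (lookup-replicate j nothing)) nothing

  ∣rowVertices∣≤ : ∀ row → ∣ rowVertices row ∣ ≤ ∑[ j < d ] ∣ edgeIn (lookup row j) ∣
  ∣rowVertices∣≤ row = union-bound (edgeIn ∘ lookup row) (∈-subsetOf⁻ (onRow? row))

  ∣touched∣≤ : ∀ rows → ∣ touched rows ∣ ≤ ∑[ u < n ] ∣ rowVertices (lookup rows u) ∣
  ∣touched∣≤ rows = union-bound (rowVertices ∘ lookup rows) (∈-subsetOf⁻ (touched? rows))

  module Promise {E : Hypergraph n} (A : Oracle n d) (uniform : Uniform k E) (rep : Represents A E) where

    K : ℕ
    K = suc (d * k)

    ∣row∣≤ : ∀ u → ∣ rowVertices (A u) ∣ ≤ d * k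
    ∣row∣≤ u = ≤-trans (∣rowVertices∣≤ (A u)) (≤-trans (∑-mono-≤ slot) (≤-reflexive (∑-const d k)))
      where
      slot : ∀ j → ∣ edgeIn (lookup (A u) j) ∣ ≤ k
      slot j with lookup (A u) j in Auj
      ... | nothing = ≤-trans (≤-reflexive (∣⊥∣≡0 n)) z≤n
      ... | just e  = ≤-reflexive (uniform e (listed-edge A rep Auj))

    ∣blank∣≡0 : ∣ rowVertices blank ∣ ≡ 0
    ∣blank∣≡0 = n≤0⇒n≡0 (≤-trans (∣rowVertices∣≤ blank) (≤-reflexive (trans (sum-cong-≗ empty) (trans (∑-const d 0) (*-zeroʳ d)))))
      where
      empty : ∀ j → ∣ edgeIn (lookup blank j) ∣ ≡ 0
      empty j = trans (cong (∣_∣ ∘ edgeIn) (lookup-replicate j nothing)) (∣⊥∣≡0 n)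

    ∣next∣≤ : ∀ V → ∣ next A V ∣ ≤ K * ∣ V ∣
    ∣next∣≤ V = begin
      ∣ next A V ∣                                         ≤⟨ ∣p∪q∣≤∣p∣+∣q∣ V _ ⟩
      ∣ V ∣ + ∣ touched (view A V) ∣                        ≤⟨ +-monoʳ-≤ ∣ V ∣ (∣touched∣≤ (view A V)) ⟩
      ∣ V ∣ + ∑[ u < n ] ∣ rowVertices (lookup (view A V) u) ∣ ≤⟨ +-monoʳ-≤ ∣ V ∣ (∑-mono-≤ row) ⟩
      ∣ V ∣ + ∑[ u < n ] (χ (lookup V u) * (d * k))        ≡⟨ cong (∣ V ∣ +_) (*-distribʳ-sum (d * k) (χ ∘ lookup V)) ⟨
      ∣ V ∣ + (∑[ u < n ] χ (lookup V u)) * (d * k)        ≡⟨ cong (λ s → ∣ V ∣ + s * (d * k)) (∣p∣≡∑χ V) ⟨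
      ∣ V ∣ + ∣ V ∣ * (d * k)                               ≡⟨ cong (∣ V ∣ +_) (*-comm ∣ V ∣ (d * k)) ⟩
      K * ∣ V ∣                                            ∎
      where
      open ≤-Reasoning
      row : ∀ u → ∣ rowVertices (lookup (view A V) u) ∣ ≤ χ (lookup V u) * (d * k)
      row u rewrite lookup-view A V u with lookup V u
      ... | true  = ≤-trans (∣row∣≤ u) (≤-reflexive (sym (+-identityʳ _)))
      ... | false = ≤-reflexive ∣blank∣≡0

    ∣fold∣≤ : ∀ V r → ∣ fold V (next A) r ∣ ≤ K ^ r * ∣ V ∣
    ∣fold∣≤ V zero    = ≤-reflexive (sym (+-identityʳ _))
    ∣fold∣≤ V (suc r) = ≤-trans (∣next∣≤ (fold V (next A) r))
                                (≤-trans (*-monoʳ-≤ K (∣fold∣≤ V r)) (≤-reflexive (sym (*-assoc K (K ^ r) ∣ V ∣))))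

    cost-grow : ∀ r V → cost (grow r V) A ≤ r * (d * (K ^ r * ∣ V ∣))

    -- Both grow (suc r) and test have this shape.
    cost-grow-query : ∀ {R} r V (f : Subset n → Vec Row n → R) →
      cost (grow r V >>= λ W → queryRows W >>= λ rows → return (f W rows)) A ≤ suc r * (d * (K ^ r * ∣ V ∣))
    cost-grow-query r V f = begin
      cost (grow r V >>= λ W → queryRows W >>= λ rows → return (f W rows)) A
        ≡⟨ cost->>= (grow r V) _ A ⟩
      cost (grow r V) A + cost (queryRows W >>= λ rows → return (f W rows)) A
        ≡⟨ cong (cost (grow r V) A +_) (trans (cost->>= (queryRows W) _ A) (+-identityʳ _)) ⟩
      cost (grow r V) A + cost (queryRows W) A
        ≤⟨ +-mono-≤ (cost-grow r V) (≤-reflexive (cost-queryRows A W)) ⟩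
      r * (d * (K ^ r * ∣ V ∣)) + ∣ W ∣ * d
        ≤⟨ +-monoʳ-≤ (r * _) (≤-trans (≤-reflexive (*-comm ∣ W ∣ d)) (*-monoʳ-≤ d ∣W∣≤)) ⟩
      r * (d * (K ^ r * ∣ V ∣)) + d * (K ^ r * ∣ V ∣)
        ≡⟨ +-comm (r * _) _ ⟩
      suc r * (d * (K ^ r * ∣ V ∣)) ∎
      where
      open ≤-Reasoning
      W = eval (grow r V) A
      ∣W∣≤ : ∣ W ∣ ≤ K ^ r * ∣ V ∣
      ∣W∣≤ = subst (λ W → ∣ W ∣ ≤ K ^ r * ∣ V ∣) (sym (eval-grow A r V)) (∣fold∣≤ V r)

    cost-grow zero    V = z≤n
    cost-grow (suc r) V = ≤-trans (cost-grow-query r V λ W rows → W ∪ touched rows)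
      (*-monoʳ-≤ (suc r) (*-monoʳ-≤ d (*-monoˡ-≤ ∣ V ∣ (m≤n*m (K ^ r) K))))

    cost-test : ∀ v → cost (test v) A ≤ testBudget d k rounds
    cost-test v = ≤-trans (cost-grow-query rounds ⁅ v ⁆ λ _ rows → does (colourable? rows))
      (≤-reflexive (cong (λ s → suc rounds * (d * s)) (trans (cong (K ^ rounds *_) (∣⁅x⁆∣≡1 v)) (*-identityʳ _))))

    cost-testAll : ∀ {M} (vs : Fin M → Fin n) → cost (testAll vs) A ≤ M * testBudget d k rounds
    cost-testAll {M = zero}  vs = z≤n
    cost-testAll {M = suc M} vs = begin
      cost (testAll vs) A
        ≡⟨ cost->>= (test (vs zero)) _ A ⟩
      cost (test (vs zero)) A + cost (testAll (vs ∘ suc) >>= λ c → return (eval (test (vs zero)) A ∧ c)) A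
        ≡⟨ cong (cost (test (vs zero)) A +_) (trans (cost->>= (testAll (vs ∘ suc)) _ A) (+-identityʳ _)) ⟩
      cost (test (vs zero)) A + cost (testAll (vs ∘ suc)) A
        ≤⟨ +-mono-≤ (cost-test (vs zero)) (cost-testAll (vs ∘ suc)) ⟩
      suc M * testBudget d k rounds ∎
      where open ≤-Reasoning

  module _ {E : Hypergraph n} (A : Oracle n d) (rep : Represents A E) where

    passes-complete : Partite k E → ∀ v → passes A v ≡ true
    passes-complete (c , proper) v =
      dec-true (colourable? (view A (explored A v))) (funToFin c , Equivalence.from (coloursRows-view A (explored A v)) rows)
      where
      rows : ColoursRowsOf A (finToFun (funToFin c)) (explored A v)
      rows {u} _ j with lookup (A u) j in Auj
      ... | nothing = nothing
      ... | just e  = just λ a b a∈e b∈e a≢b →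
        subst₂ _≢_ (sym (finToFun-funToFin c a)) (sym (finToFun-funToFin c b))
               (proper e (listed-edge A rep Auj) a b a∈e b∈e a≢b)

    passes-sound : ∀ {v} → passes A v ≡ true → ∃ λ (s : Fin (k ^ n)) → ColoursRowsOf A (finToFun s) (explored A v)
    passes-sound {v} pv = let s , cols = does≡true⇒ (colourable? (view A (explored A v))) pv
                          in s , Equivalence.to (coloursRows-view A (explored A v)) cols

    expand⊆next : ∀ {F} → (∀ {e} → F e ≡ true → E e ≡ true) → ∀ {p q} → p ⊆ q → Balls.expand F p ⊆ next A q
    expand⊆next {F} F⊆E {p} {q} p⊆q {w} w∈ with Balls.∈-expand⁻ F w∈
    ... | inj₁ w∈p = p⊆p∪q _ (p⊆q w∈p)
    ... | inj₂ (e , Fe , (u , u∈e , u∈p) , w∈e) = q⊆p∪q q _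
      (∈-subsetOf⁺ (touched? (view A q)) (u , ∈-subsetOf⁺ (onRow? (lookup (view A q) u)) (j , w∈slot)))
      where
      slot = listed A rep (F⊆E Fe) u∈e
      j = proj₁ slot
      w∈slot : w ∈ edgeIn (lookup (lookup (view A q) u) j)
      w∈slot = subst (λ row → w ∈ edgeIn (lookup row j)) (sym (lookup-view-∈ A (p⊆q u∈p)))
                     (subst (λ s → w ∈ edgeIn s) (sym (proj₂ slot)) w∈e)

    ball⊆explored : ∀ {F} → (∀ {e} → F e ≡ true → E e ≡ true) → ∀ v → Balls.ball F v rounds ⊆ explored A v
    ball⊆explored F⊆E v = fold-⊆ (expand⊆next F⊆E) rounds id

-- Repairing an input on which most vertices pass

xor-∧≡true : ∀ a b → a xor (a ∧ b) ≡ true → a ≡ true × b ≡ false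
xor-∧≡true true false _ = refl , refl

module Repair {n d k′ S} {E : Hypergraph n} (A : Oracle n d) (uniform : Uniform (suc k′) E) (rep : Represents A E)
              {X : Subset n} (components : SmallComponents E X S) where

  open SmallComponents components
  open LocalTest n d (suc k′) (suc S)

  Good : Hypergraph n
  Good e = E e ∧ does (e ⊆? ∁ X)

  Good⊆E : ∀ {e} → Good e ≡ true → E e ≡ true
  Good⊆E {e} Ge with E e
  ... | true = refl

  Good-avoids : ∀ {e w} → Good e ≡ true → w ∈ e → w ∉ X
  Good-avoids {e} Ge w∈e with E e | e ⊆? ∁ X
  ... | true | yes e⊆∁X = x∈∁p⇒x∉p (e⊆∁X w∈e)

  open Balls Good

  component : Fin n → Subset n
  component v = ball v (suc S)

  ball⊆cell : ∀ {v} → v ∉ X → ∀ r → ball v r ⊆ cell v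
  ball⊆cell {v} v∉X = ball-least (cell-self v∉X) closed
    where
    closed : Closed (cell v)
    closed {w} w∈ with ∈-expand⁻ w∈
    ... | inj₁ w∈cell = w∈cell
    ... | inj₂ (e , Ge , (u , u∈e , u∈cell) , w∈e) with u ≟ w
    ...   | yes refl = u∈cell
    ...   | no u≢w   = cell-closed u∈cell (Good-avoids Ge w∈e) (u≢w , e , Good⊆E Ge , u∈e , w∈e)

  component-closed : ∀ {v} → v ∉ X → Closed (component v)
  component-closed {v} v∉X = ball-closed v S λ r → ≤-trans (p⊆q⇒∣p∣≤∣q∣ (ball⊆cell v∉X r)) (cell-small v)

  colouringOf : Vec Row n → Fin n → Fin (suc k′)
  colouringOf rows with colourable? rows
  ... | yes (s , _) = finToFun s
  ... | no _        = λ _ → zero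

  colouringOf-colours : ∀ {rows} → Colourable rows → ColoursRows (colouringOf rows) rows
  colouringOf-colours {rows} colourable with colourable? rows
  ... | yes (s , colours) = colours
  ... | no ¬colourable    = contradiction colourable ¬colourable

  -- All vertices of a component get their colours from one colouring, chosen from the component alone.
  colour : Fin n → Fin (suc k′)
  colour u = colouringOf (view A (component u)) u

  Bad : Subset n
  Bad = X ∪ ∁ (passing A)

  repaired : Hypergraph n
  repaired e = E e ∧ does (e ⊆? ∁ Bad)

  ∁Bad-avoids : ∀ {u} → u ∈ ∁ Bad → u ∉ X
  ∁Bad-avoids u∈∁Bad u∈X = x∈∁p⇒x∉p u∈∁Bad (p⊆p∪q _ u∈X)

  ∁Bad-passes : ∀ {u} → u ∈ ∁ Bad → passes A u ≡ true
  ∁Bad-passes {u} u∈∁Bad = trans (sym (lookup∘tabulate (passes A) u)) ([]=⇒lookup u∈passing)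
    where
    u∈passing : u ∈ (passing A)
    u∈passing = decidable-stable (u ∈? (passing A)) λ u∉ → x∈∁p⇒x∉p u∈∁Bad (q⊆p∪q X _ (x∉p⇒x∈∁p u∉))

  repaired-uniform : Uniform (suc k′) repaired
  repaired-uniform e Re with E e in Ee
  ... | true = uniform e Ee

  repaired-partite : Partite (suc k′) repaired
  repaired-partite = colour , proper
    where
    proper : ∀ e → repaired e ≡ true → Proper colour e
    proper e Re a b a∈e b∈e a≢b with E e in Ee | e ⊆? ∁ Bad
    ... | true | yes e⊆∁Bad = subst (λ C → colouringOf (view A (component a)) a ≢ colouringOf (view A C) b)
                                    same-component (cᵃ-proper a b a∈e b∈e a≢b)
      where
      a∉X = ∁Bad-avoids (e⊆∁Bad a∈e)
      Ge : Good e ≡ true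
      Ge rewrite Ee = dec-true (e ⊆? ∁ X) λ u∈e → x∉p⇒x∈∁p (∁Bad-avoids (e⊆∁Bad u∈e))

      same-component : component a ≡ component b
      same-component = ball-≡ S Ge a∈e b∈e (component-closed a∉X) (component-closed (∁Bad-avoids (e⊆∁Bad b∈e)))

      colourable : Colourable (view A (component a))
      colourable = let s , cols = passes-sound A rep (∁Bad-passes (e⊆∁Bad a∈e))
                   in s , Equivalence.from (coloursRows-view A (component a)) (cols ∘ ball⊆explored A rep Good⊆E a)

      cᵃ-proper : Proper (colouringOf (view A (component a))) e
      cᵃ-proper = let j , Aaj = listed A rep Ee a∈e in
        drop-just (subst (All _) Aaj (Equivalence.to (coloursRows-view A (component a))
                                                     (colouringOf-colours colourable) (centre∈ball a (suc S)) j))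

  _≟ₘ_ : (x y : Maybe (Subset n)) → Dec (x ≡ y)
  _≟ₘ_ = Maybe.≡-dec (Vec.≡-dec _≟ᵇ_)

  listedAt : Fin n → Subset n → Bool
  listedAt u e = does (any? λ j → lookup (A u) j ≟ₘ just e)

  count-listedAt : ∀ u → countSubsets n (listedAt u) ≤ d
  count-listedAt u = begin
    countSubsets n (listedAt u)          ≤⟨ countSubsets-union-bound n slot cover ⟩
    ∑[ j < d ] countSubsets n (slot j)   ≤⟨ ∑-mono-≤ (λ j → countSubsets-≤1 n (fromMaybe ⊥ (lookup (A u) j)) (only j)) ⟩
    ∑[ j < d ] 1                         ≡⟨ trans (∑-const d 1) (*-identityʳ d) ⟩
    d                                    ∎
    where
    open ≤-Reasoning
    slot : Fin d → Subset n → Bool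
    slot j e = does (lookup (A u) j ≟ₘ just e)
    cover : ∀ e → listedAt u e ≡ true → ∃ λ j → slot j e ≡ true
    cover e isListed = let j , Auj = does≡true⇒ (any? λ j → lookup (A u) j ≟ₘ just e) isListed
                       in j , dec-true (lookup (A u) j ≟ₘ just e) Auj
    only : ∀ j e → slot j e ≡ true → e ≡ fromMaybe ⊥ (lookup (A u) j)
    only j e Auj = cong (fromMaybe ⊥) (sym (does≡true⇒ (lookup (A u) j ≟ₘ just e) Auj))

  removed-listed : ∀ e → E e xor repaired e ≡ true → ∃ λ u → lookup Bad u ∧ listedAt u e ≡ true
  removed-listed e removed with xor-∧≡true (E e) (does (e ⊆? ∁ Bad)) removed
  ... | Ee , notKept with any? (λ u → (u ∈? e) ×-dec (u ∈? Bad))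
  ...   | yes (u , u∈e , u∈Bad) = u , subst (λ b → b ∧ listedAt u e ≡ true) (sym ([]=⇒lookup u∈Bad))
                                         (dec-true (any? λ j → lookup (A u) j ≟ₘ just e) (listed A rep Ee u∈e))
  ...   | no ¬bad = contradiction (trans (sym (dec-true (e ⊆? ∁ Bad) kept)) notKept) λ ()
    where
    kept : e ⊆ ∁ Bad
    kept u∈e = x∉p⇒x∈∁p λ u∈Bad → ¬bad (_ , u∈e , u∈Bad)

  symDiff-repaired : symDiff E repaired ≤ ∣ Bad ∣ * d
  symDiff-repaired = begin
    symDiff E repaired
      ≤⟨ countSubsets-union-bound n (λ u e → lookup Bad u ∧ listedAt u e) removed-listed ⟩
    ∑[ u < n ] countSubsets n (λ e → lookup Bad u ∧ listedAt u e)
      ≤⟨ ∑-mono-≤ perVertex ⟩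
    ∑[ u < n ] (χ (lookup Bad u) * d)
      ≡⟨ *-distribʳ-sum d (χ ∘ lookup Bad) ⟨
    (∑[ u < n ] χ (lookup Bad u)) * d
      ≡⟨ cong (_* d) (∣p∣≡∑χ Bad) ⟨
    ∣ Bad ∣ * d
      ∎
    where
    open ≤-Reasoning
    perVertex : ∀ u → countSubsets n (λ e → lookup Bad u ∧ listedAt u e) ≤ χ (lookup Bad u) * d
    perVertex u with lookup Bad u
    ... | true  = ≤-trans (count-listedAt u) (≤-reflexive (sym (+-identityʳ d)))
    ... | false = ≤-reflexive (countSubsets-false n λ _ → refl)

  ∣Bad∣≤ : ∣ Bad ∣ ≤ ∣ X ∣ + (n ∸ ∣ passing A ∣)
  ∣Bad∣≤ = ≤-trans (∣p∪q∣≤∣p∣+∣q∣ X (∁ (passing A))) (≤-reflexive (cong (∣ X ∣ +_) (∣∁p∣≡n∸∣p∣ (passing A))))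

-- Arithmetic

toℚᵘ-/1 : ∀ a → ℚ.toℚᵘ (ℤ.+ a / 1) ℚᵘ.≃ ℚᵘ.mkℚᵘ (ℤ.+ a) 0
toℚᵘ-/1 a = ℚ.toℚᵘ-fromℚᵘ (ℚᵘ.mkℚᵘ (ℤ.+ a) 0)

-- ε = p/D with p ≥ 1, so ε ≥ 1/D.
<-denominator : ∀ (ε : ℚ) → 0ℚ ℚ.< ε → ∀ a b → ε ℚ.* (ℤ.+ a / 1) ℚ.< ℤ.+ b / 1 → a < ℚ.ℚ.denominatorℕ ε * b
<-denominator (mkℚ (ℤ.+ zero) _ _) 0<ε a b _ with ℚ.positive 0<ε
... | ()
<-denominator (mkℚ ℤ.-[1+ _ ] _ _) 0<ε a b _ with ℚ.positive 0<ε
... | ()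
<-denominator ε@(mkℚ (ℤ.+ suc p) e _) _ a b ε·a<b with
  ℚᵘ.<-respʳ-≃ (toℚᵘ-/1 b) (ℚᵘ.<-respˡ-≃ (ℚᵘ.*-congˡ {ℚ.toℚᵘ ε} (toℚᵘ-/1 a))
    (ℚᵘ.<-respˡ-≃ (ℚ.toℚᵘ-homo-* ε (ℤ.+ a / 1)) (ℚ.toℚᵘ-mono-< ε·a<b)))
... | ℚᵘ.*<* p·a<b·D =
  ≤-<-trans (m≤n*m a (suc p)) (subst₂ _<_ (*-identityʳ (suc p * a)) b·D≡D·b (ℤ.drop‿+<+ (subst₂ ℤ._<_ lhs rhs p·a<b·D)))
  where
  lhs : ℤ.+ suc p ℤ.* ℤ.+ a ℤ.* ℤ.+ 1 ≡ ℤ.+ (suc p * a * 1)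
  lhs = trans (cong (ℤ._* ℤ.+ 1) (sym (ℤ.pos-* (suc p) a))) (sym (ℤ.pos-* (suc p * a) 1))
  rhs : ℤ.+ b ℤ.* ℤ.+ (suc e * 1) ≡ ℤ.+ (b * (suc e * 1))
  rhs = sym (ℤ.pos-* b (suc e * 1))
  b·D≡D·b : b * (suc e * 1) ≡ suc e * b
  b·D≡D·b = trans (cong (b *_) (*-identityʳ (suc e))) (*-comm b (suc e))

*-^-distrib : ∀ x y m → (x * y) ^ m ≡ x ^ m * y ^ m
*-^-distrib x y zero    = refl
*-^-distrib x y (suc m) = trans (cong (x * y *_) (*-^-distrib x y m))
  (solve 4 (λ x y P Q → x :* y :* (P :* Q) := x :* P :* (y :* Q)) refl x y (x ^ m) (y ^ m))

-- Bernoulli's inequality (1 + 1/a)^j ≥ 1 + j/a, cleared of denominators.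
bernoulli : ∀ a j → a ^ j * (a + j) ≤ a * suc a ^ j
bernoulli a zero    = ≤-reflexive (solve 1 (λ a → con 1 :* (a :+ con 0) := a :* con 1) refl a)
bernoulli a (suc j) = begin
  a * a ^ j * (a + suc j)                  ≤⟨ m≤m+n _ (a ^ j * j) ⟩
  a * a ^ j * (a + suc j) + a ^ j * j      ≡⟨ solve 3 (λ a P j → a :* P :* (a :+ (con 1 :+ j)) :+ P :* j
                                                         := (con 1 :+ a) :* (P :* (a :+ j))) refl a (a ^ j) j ⟩
  suc a * (a ^ j * (a + j))                ≤⟨ *-monoʳ-≤ (suc a) (bernoulli a j) ⟩
  suc a * (a * suc a ^ j)                  ≡⟨ solve 3 (λ a b Q → b :* (a :* Q) := a :* (b :* Q)) refl a (suc a) (suc a ^ j) ⟩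
  a * (suc a * suc a ^ j)                  ∎
  where open ≤-Reasoning

-- (1 + 1/a)^(2a) ≥ 4 > 3
amplify : ∀ {a n g} → 1 ≤ a → suc a * g ≤ a * n → 3 * g ^ (a + a) ≤ n ^ (a + a)
amplify {a@(suc a′)} {n} {g} _ fraction = *-cancelˡ-≤ (suc a ^ M) {{m^n≢0 (suc a) M}} (begin
  suc a ^ M * (3 * g ^ M)     ≡⟨ solve 2 (λ X Y → X :* (con 3 :* Y) := con 3 :* (X :* Y)) refl (suc a ^ M) (g ^ M) ⟩
  3 * (suc a ^ M * g ^ M)     ≡⟨ cong (3 *_) (*-^-distrib (suc a) g M) ⟨
  3 * (suc a * g) ^ M         ≤⟨ *-monoʳ-≤ 3 (^-monoˡ-≤ M fraction) ⟩
  3 * (a * n) ^ M             ≡⟨ cong (3 *_) (*-^-distrib a n M) ⟩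
  3 * (a ^ M * n ^ M)         ≡⟨ *-assoc 3 (a ^ M) (n ^ M) ⟨
  3 * a ^ M * n ^ M           ≤⟨ *-monoˡ-≤ (n ^ M) three ⟩
  suc a ^ M * n ^ M           ∎)
  where
  open ≤-Reasoning
  M = a + a
  twice : 2 * a ^ a ≤ suc a ^ a
  twice = *-cancelˡ-≤ a (begin
    a * (2 * a ^ a)  ≡⟨ solve 2 (λ x P → x :* (con 2 :* P) := P :* (x :+ x)) refl a (a ^ a) ⟩
    a ^ a * (a + a)  ≤⟨ bernoulli a a ⟩
    a * suc a ^ a    ∎)
  three : 3 * a ^ M ≤ suc a ^ M
  three = begin
    3 * a ^ M                    ≤⟨ *-monoˡ-≤ (a ^ M) (n≤1+n 3) ⟩
    4 * a ^ M                    ≡⟨ cong (4 *_) (^-distribˡ-+-* a a a) ⟩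
    4 * (a ^ a * a ^ a)          ≡⟨ solve 1 (λ P → con 4 :* (P :* P) := (con 2 :* P) :* (con 2 :* P)) refl (a ^ a) ⟩
    (2 * a ^ a) * (2 * a ^ a)    ≤⟨ *-mono-≤ twice twice ⟩
    suc a ^ a * suc a ^ a        ≡⟨ ^-distribˡ-+-* (suc a) a a ⟨
    suc a ^ M                    ∎

passing-fraction : ∀ {a n x g} → suc a * x ≤ n → n + n < suc a * (x + (n ∸ g)) → g ≤ n → suc a * g ≤ a * n
passing-fraction {a} {n} {x} {g} x-small many-bad g≤n = <⇒≤ (+-cancelˡ-< n (suc a * g) (a * n) (begin-strict
  n + suc a * g        ≡⟨ +-comm n _ ⟩
  suc a * g + n        <⟨ +-monoʳ-< (suc a * g) n<B ⟩
  suc a * g + B        ≡⟨ *-distribˡ-+ (suc a) g b ⟨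
  suc a * (g + b)      ≡⟨ cong (suc a *_) (m+[n∸m]≡n g≤n) ⟩
  n + a * n            ∎))
  where
  open ≤-Reasoning
  b = n ∸ g
  B = suc a * b
  n<B : n < B
  n<B = +-cancelˡ-< n n B (begin-strict
    n + n                <⟨ many-bad ⟩
    suc a * (x + b)      ≡⟨ *-distribˡ-+ (suc a) x b ⟩
    suc a * x + B        ≤⟨ +-monoˡ-≤ B x-small ⟩
    n + B                ∎)

-- The tester

partite⇒¬far : ∀ {n k d ε} {E : Hypergraph n} → 0ℚ ℚ.< ε → Uniform k E → Partite k E → ¬ FarFromPartite k d ε E
partite⇒¬far {n} {d = d} {ε} {E} 0<ε uniform partite far =
  n≮0 (subst (d * n <_) (trans (cong (ℚ.ℚ.denominatorℕ ε *_) symDiff≡0) (*-zeroʳ (ℚ.ℚ.denominatorℕ ε)))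
             (<-denominator ε 0<ε (d * n) (symDiff E E) (far E uniform partite)))
  where
  symDiff≡0 : symDiff E E ≡ 0
  symDiff≡0 = countSubsets-false n (xor-same ∘ E)

module Tester (k′ d t : ℕ) (ε : ℚ) (0<ε : 0ℚ ℚ.< ε) where

  -- suc S = suc a * suc t makes the separator delete at most n / suc a vertices, under half of the
  -- more than n / D vertices that an ε-far input forces to be deleted or to fail.
  k D a S M rounds queries : ℕ
  k       = suc k′
  D       = ℚ.ℚ.denominatorℕ ε
  a       = D + D
  S       = t + a * suc t
  M       = a + a
  rounds  = suc S
  queries = M * testBudget d k rounds

  tuples≡ : ∀ n′ → suc (pred (suc n′ ^ M)) ≡ suc n′ ^ M
  tuples≡ n′ = suc-pred (suc n′ ^ M) {{m^n≢0 (suc n′) M}}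

  tester : ∀ n → RandomizedTester n d queries
  tester zero     = record { r = 0 ; trees = λ _ → leaf true }
  tester (suc n′) = record
    { r     = pred (suc n′ ^ M)
    ; trees = λ s → Queries.toTree (suc n′) d queries
                      (LocalTest.testAll (suc n′) d k rounds (finToFun {suc n′} {M} (cast (tuples≡ n′) s)))
    }

  module _ {n′} {E : Hypergraph (suc n′)} {A : Oracle (suc n′) d} (uniform : Uniform k E) (rep : Represents A E) where
    private n = suc n′
    open LocalTest n d k rounds
    open Promise A uniform rep using (cost-testAll)

    sample : Fin (n ^ M) → Fin M → Fin n
    sample = finToFun {n} {M}

    runs : ∀ s → run (trees (tester n) s) A ≡ allᵇ (passes A) (sample (cast (tuples≡ n′) s))
    runs s = trans (Queries.run-toTree n d (testAll (sample (cast (tuples≡ n′) s))) A (cost-testAll (sample (cast (tuples≡ n′) s))))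
                   (eval-testAll A (sample (cast (tuples≡ n′) s)))

    accepted : acceptCount (tester n) A ≡ ∣ passing A ∣ ^ M
    accepted = begin
      acceptCount (tester n) A
        ≡⟨ countFin≡∑χ (suc (pred (n ^ M))) (λ s → run (trees (tester n) s) A) ⟩
      ∑[ s < suc (pred (n ^ M)) ] χ (run (trees (tester n) s) A)
        ≡⟨ sum-cong-≗ (cong χ ∘ runs) ⟩
      ∑[ s < suc (pred (n ^ M)) ] χ (allᵇ (passes A) (sample (cast (tuples≡ n′) s)))
        ≡⟨ ∑-cast (tuples≡ n′) (χ ∘ allᵇ (passes A) ∘ sample) ⟩
      ∑[ s < n ^ M ] χ (allᵇ (passes A) (sample s))
        ≡⟨ count-tuples M (passes A) ⟩
      (∑[ u < n ] χ (passes A u)) ^ M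
        ≡⟨ cong (_^ M) (∣tabulate∣≡∑χ (passes A)) ⟨
      ∣ passing A ∣ ^ M
        ∎
      where open ≡-Reasoning

    complete-pos : Partite k E → 2 * numSeeds (tester n) ≤ 3 * acceptCount (tester n) A
    complete-pos partite = subst₂ (λ seeds acc → 2 * seeds ≤ 3 * acc) (sym (tuples≡ n′)) (sym all-accepted)
                                  (*-monoˡ-≤ (n ^ M) {2} {3} (s≤s (s≤s z≤n)))
      where
      all-pass : ∣ passing A ∣ ≡ n
      all-pass = trans (∣tabulate∣≡∑χ (passes A))
                       (trans (sum-cong-≗ (cong χ ∘ passes-complete A rep partite)) (trans (∑-const n 1) (*-identityʳ n)))
      all-accepted : acceptCount (tester n) A ≡ n ^ M
      all-accepted = trans accepted (cong (_^ M) all-pass)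

    few-pass : ∀ {X} → suc S * ∣ X ∣ ≤ suc t * n → SmallComponents E X S → FarFromPartite k d ε E →
               suc a * ∣ passing A ∣ ≤ a * n
    few-pass {X} X-small components far = passing-fraction {a} {n} {∣ X ∣} X-fraction many-bad (∣p∣≤n (passing A))
      where
      open Repair A uniform rep components
      open ≤-Reasoning
      x = ∣ X ∣
      b = n ∸ ∣ passing A ∣

      X-fraction : suc a * x ≤ n
      X-fraction = *-cancelˡ-≤ (suc t) (begin
        suc t * (suc a * x)      ≡⟨ *-assoc (suc t) (suc a) x ⟨
        suc t * suc a * x        ≡⟨ cong (_* x) (*-comm (suc t) (suc a)) ⟩
        suc S * x                ≤⟨ X-small ⟩
        suc t * n                ∎)

      n<D[x+b] : n < D * (x + b)
      n<D[x+b] = *-cancelˡ-< d n (D * (x + b)) (begin-strict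
        d * n                    <⟨ <-denominator ε 0<ε (d * n) (symDiff E repaired)
                                                  (far repaired repaired-uniform repaired-partite) ⟩
        D * symDiff E repaired   ≤⟨ *-monoʳ-≤ D (≤-trans symDiff-repaired (*-monoˡ-≤ d ∣Bad∣≤)) ⟩
        D * ((x + b) * d)        ≡⟨ cong (D *_) (*-comm (x + b) d) ⟩
        D * (d * (x + b))        ≡⟨ *-assoc D d (x + b) ⟨
        D * d * (x + b)          ≡⟨ cong (_* (x + b)) (*-comm D d) ⟩
        d * D * (x + b)          ≡⟨ *-assoc d D (x + b) ⟩
        d * (D * (x + b))        ∎)

      many-bad : n + n < suc a * (x + b)
      many-bad = begin-strict
        n + n                    <⟨ +-mono-< n<D[x+b] n<D[x+b] ⟩
        D * (x + b) + D * (x + b) ≡⟨ *-distribʳ-+ (x + b) D D ⟨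
        a * (x + b)              ≤⟨ m≤n+m (a * (x + b)) (x + b) ⟩
        suc a * (x + b)          ∎

    sound-pos : TreewidthAtMost t E → FarFromPartite k d ε E → 3 * acceptCount (tester n) A ≤ numSeeds (tester n)
    sound-pos tw far = let X , X-small , components = separator tw S in
      subst₂ (λ acc seeds → 3 * acc ≤ seeds) (sym accepted) (sym (tuples≡ n′))
             (amplify {a} {n} {∣ passing A ∣} (s≤s z≤n) (few-pass X-small components far))

  completeness : ∀ n {E : Hypergraph n} {A : Oracle n d} → Uniform k E → Represents A E → Partite k E →
                 2 * numSeeds (tester n) ≤ 3 * acceptCount (tester n) A
  completeness zero     _       _   _ = s≤s (s≤s z≤n)
  completeness (suc n′) uniform rep   = complete-pos uniform rep

  soundness : ∀ n {E : Hypergraph n} {A : Oracle n d} → Uniform k E → Represents A E → TreewidthAtMost t E →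
              FarFromPartite k d ε E → 3 * acceptCount (tester n) A ≤ numSeeds (tester n)
  soundness zero     uniform _   _ far = contradiction far (partite⇒¬far {d = d} 0<ε uniform ((λ ()) , λ _ _ ()))
  soundness (suc n′) uniform rep       = sound-pos uniform rep

theorem3 : ∀ (k d t : ℕ) (ε : ℚ) → 3 ≤ k → 0ℚ ℚ.< ε → ε ℚ.< 1ℚ →
    Σ ℕ λ q → ∀ (n : ℕ) → Σ (RandomizedTester n d q) λ T →
    ∀ (E : Hypergraph n) (A : Oracle n d) →
    Uniform k E → Represents A E → TreewidthAtMost t E →
    (Partite k E → 2 * numSeeds T ≤ 3 * acceptCount T A)
    × (FarFromPartite k d ε E → 3 * acceptCount T A ≤ numSeeds T)
theorem3 (suc k′) d t ε (s≤s _) 0<ε _ = queries , λ n → tester n , λ E A uniform rep treewidth →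
  completeness n uniform rep , soundness n uniform rep treewidth
  where open Tester k′ d t ε 0<ε
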